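{- For every $C<\infty$ and every integer $\ell\ge1$ there is a constant $C'<\infty$ such that the following holds. Let $n\ge1$ and $d_1,\dots,d_n\ge0$ be integers with $N=\sum_i d_i$ even, $N\ge2$, and $\sum_i d_i^2\le CN$. Then for every vertex $i$, $$\bigl|\mathbb{E}X_i^\ell-\mathbb{E}\hat X_i^\ell\bigr|\le C'N^{ -1/2}\lambda_i.$$
   Context: Configuration model: attach $d_i$ half-edges to vertex $i\in\{1,\dots,n\}$ and pair all $N$ half-edges by a uniformly random perfect matching; each pair forms an edge (a loop if both half-edges belong to the same vertex). $X_i$ is the number of loops at vertex $i$ in the resulting random multigraph. $\lambda_i=\frac{d_i(d_i-1)}{2N}$ and $\hat X_i\sim\mathrm{Po}(\lambda_i)$.
   Formalization: The constant C ranges over ℚ, and the constant C' is taken in ℚ. -}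

module Defs where

open import Data.Nat as ℕ using (ℕ; zero; suc; _≡ᵇ_)
open import Data.Fin using (Fin; _≟_)
open import Data.Bool using (if_then_else_)
open import Data.List using (List; []; _∷_; length; map; concatMap; replicate; allFin)
open import Data.Nat.ListAction using (sum)
open import Data.Product using (_×_; _,_)
open import Data.Integer using (+_)
open import Data.Rational using (ℚ; 0ℚ; _+_; _*_; _/_)
open import Relation.Nullary.Decidable using (does)

totalDeg : {n : ℕ} → (Fin n → ℕ) → ℕ
totalDeg {n} d = sum (map d (allFin n))

sumSqDeg : {n : ℕ} → (Fin n → ℕ) → ℕ
sumSqDeg {n} d = sum (map (λ i → d i ℕ.* d i) (allFin n))

-- The list of half-edges, each labelled by the vertex it belongs to:
-- vertex i contributes d_i half-edges.  Half-edges are distinguished by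
-- their position in this list.
halfEdges : {n : ℕ} → (Fin n → ℕ) → List (Fin n)
halfEdges {n} d = concatMap (λ i → replicate (d i) i) (allFin n)

picks : {A : Set} → List A → List (A × List A)
picks [] = []
picks (x ∷ xs) = (x , xs) ∷ map (λ { (y , ys) → (y , x ∷ ys) }) (picks xs)

-- Fuel-based recursion; the fuel (length of the list) is always sufficient.
matchingsF : {A : Set} → ℕ → List A → List (List (A × A))
matchingsF _ [] = [] ∷ []
matchingsF zero (_ ∷ _) = []
matchingsF (suc k) (x ∷ xs) =
  concatMap (λ { (y , rest) → map ((x , y) ∷_) (matchingsF k rest) }) (picks xs)

matchings : {A : Set} → List A → List (List (A × A))
matchings xs = matchingsF (length xs) xs

loopsAt : {n : ℕ} → Fin n → List (Fin n × Fin n) → ℕ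
loopsAt i [] = 0
loopsAt i ((a , b) ∷ m) =
  (if does (a ≟ i) then (if does (b ≟ i) then 1 else 0) else 0) ℕ.+ loopsAt i m

-- Uniform average of a list of naturals (0 for the empty list, which never
-- occurs when N is even).
average : List ℕ → ℚ
average xs with length xs
... | zero = 0ℚ
... | suc k = (+ sum xs) / suc k

-- E X_i^ℓ in the configuration model with degree sequence d:
-- average of (number of loops at i)^ℓ over all perfect matchings of the
-- half-edges (uniform random perfect matching).
momentLoops : {n : ℕ} → (Fin n → ℕ) → Fin n → ℕ → ℚ
momentLoops d i ℓ = average (map (λ m → loopsAt i m ℕ.^ ℓ) (matchings (halfEdges d)))

-- λ_i = d_i (d_i - 1) / (2N)   (0 if N = 0, which is excluded by N ≥ 2).
lam : {n : ℕ} → (Fin n → ℕ) → Fin n → ℚ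
lam d i with totalDeg d
... | zero = 0ℚ
... | suc k = (+ (d i ℕ.* (d i ℕ.∸ 1))) / (2 ℕ.* suc k)

stirling2 : ℕ → ℕ → ℕ
stirling2 zero zero = 1
stirling2 zero (suc k) = 0
stirling2 (suc ℓ) zero = 0
stirling2 (suc ℓ) (suc k) = suc k ℕ.* stirling2 ℓ (suc k) ℕ.+ stirling2 ℓ k

powℚ : ℚ → ℕ → ℚ
powℚ q zero = Data.Rational.1ℚ
powℚ q (suc k) = q * powℚ q k

-- E[Po(λ)^ℓ] = Σ_{k=0}^{ℓ} S(ℓ,k) λ^k  (Touchard polynomial).
poissonMoment : ℚ → ℕ → ℚ
poissonMoment λ' ℓ = go ℓ
  where
  go : ℕ → ℚ
  go zero = ((+ stirling2 ℓ 0) / 1) * powℚ λ' 0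
  go (suc k) = ((+ stirling2 ℓ (suc k)) / 1) * powℚ λ' (suc k) + go k

-- Let a = dᵢ be the number of half-edges at i among N. The factorial moment E (Xᵢ)ₖ counts
-- pairs (matching, ordered k-tuple of loops at i) against the (N - 1)!! matchings, so
-- E (Xᵢ)ₖ = C(a,2) C(a-2,2) ⋯ / ((N - 1)(N - 3) ⋯) with k factors each. Comparing numerator and
-- denominator with C(a,2)ᵏ and Nᵏ, and using a² ≤ C N, gives E (Xᵢ)ₖ = λᵢᵏ + O(λᵢ (a + 1) / N).
-- Since xˡ = Σₖ S(ℓ,k) (x)ₖ and E Po(λ)ˡ = Σₖ S(ℓ,k) λᵏ, the ℓ-th moments differ by the same
-- order, and (a + 1)² ≤ (C + 1)² N turns λᵢ (a + 1) / N into O(λᵢ / √N).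
module Submission where

module ListSums where

  open import Data.Nat using (ℕ; _+_; _*_)
  open import Data.Nat.Properties using (*-zeroʳ; *-distribˡ-+)
  open import Data.Nat.ListAction using (sum)
  open import Data.Nat.ListAction.Properties using (sum-++)
  open import Data.List using (List; []; _∷_; _++_; map; concatMap)
  open import Data.List.Properties using (map-++)
  open import Relation.Binary.PropositionalEquality
  open import Algebra.Properties.CommutativeSemigroup Data.Nat.Properties.+-commutativeSemigroup using (interchange)

  private variable A B : Set

  sum-concatMap : (f : B → ℕ) (g : A → List B) (xs : List A) →
    sum (map f (concatMap g xs)) ≡ sum (map (λ x → sum (map f (g x))) xs)
  sum-concatMap f g []       = refl
  sum-concatMap f g (x ∷ xs) = begin
    sum (map f (g x ++ concatMap g xs))            ≡⟨ cong sum (map-++ f (g x) (concatMap g xs)) ⟩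
    sum (map f (g x) ++ map f (concatMap g xs))    ≡⟨ sum-++ (map f (g x)) _ ⟩
    sum (map f (g x)) + sum (map f (concatMap g xs)) ≡⟨ cong (sum (map f (g x)) +_) (sum-concatMap f g xs) ⟩
    sum (map f (g x)) + sum (map (λ x → sum (map f (g x))) xs) ∎
    where open ≡-Reasoning

  sum-map-+ : (f g : A → ℕ) (xs : List A) →
    sum (map (λ x → f x + g x) xs) ≡ sum (map f xs) + sum (map g xs)
  sum-map-+ f g []       = refl
  sum-map-+ f g (x ∷ xs) = trans (cong (f x + g x +_) (sum-map-+ f g xs)) (interchange (f x) (g x) _ _)

  sum-map-*ˡ : (c : ℕ) (f : A → ℕ) (xs : List A) →
    sum (map (λ x → c * f x) xs) ≡ c * sum (map f xs)
  sum-map-*ˡ c f []       = sym (*-zeroʳ c)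
  sum-map-*ˡ c f (x ∷ xs) = trans (cong (c * f x +_) (sum-map-*ˡ c f xs)) (sym (*-distribˡ-+ c (f x) _))

module FallingFactorial where

  open import Data.Nat using (ℕ; zero; suc; _+_; _*_; pred)
  open import Data.Nat.Properties
  open import Relation.Binary.PropositionalEquality
  open import Data.Nat.Solver using (module +-*-Solver)
  open +-*-Solver

  falling : ℕ → ℕ → ℕ
  falling s zero    = 1
  falling s (suc k) = s * falling (pred s) k

  *-falling : ∀ s k → s * falling s k ≡ falling s (suc k) + k * falling s k
  *-falling s       zero    = sym (+-identityʳ (s * 1))
  *-falling zero    (suc k) = sym (*-zeroʳ (suc k))
  *-falling (suc s) (suc k) = begin
    suc s * (suc s * X)
      ≡⟨ solve 2 (λ s x → (con 1 :+ s) :* ((con 1 :+ s) :* x) := (con 1 :+ s) :* (s :* x) :+ (con 1 :+ s) :* x) refl s X ⟩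
    suc s * (s * X) + suc s * X
      ≡⟨ cong (λ y → suc s * y + suc s * X) (*-falling s k) ⟩
    suc s * (Y + k * X) + suc s * X
      ≡⟨ solve 4 (λ s y k x → (con 1 :+ s) :* (y :+ k :* x) :+ (con 1 :+ s) :* x
                             := (con 1 :+ s) :* y :+ (con 1 :+ k) :* ((con 1 :+ s) :* x)) refl s Y k X ⟩
    suc s * Y + suc k * (suc s * X) ∎
    where
    open ≡-Reasoning
    X = falling s k
    Y = falling s (suc k)

  falling-suc : ∀ s k → falling (suc s) (suc k) ≡ falling s (suc k) + suc k * falling s k
  falling-suc s k = begin
    falling s k + s * falling s k
      ≡⟨ cong (falling s k +_) (*-falling s k) ⟩
    falling s k + (falling s (suc k) + k * falling s k)
      ≡⟨ solve 3 (λ x y k → x :+ (y :+ k :* x) := y :+ (con 1 :+ k) :* x) refl (falling s k) (falling s (suc k)) k ⟩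
    falling s (suc k) + suc k * falling s k ∎
    where open ≡-Reasoning

module StirlingExpansion where

  open import Defs using (stirling2)
  open FallingFactorial
  open import Data.Nat using (ℕ; zero; suc; _+_; _*_; _^_)
  open import Data.Nat.Properties
  open import Data.Nat.ListAction using (sum)
  open import Data.List using (List; []; _∷_; map)
  open import Relation.Binary.PropositionalEquality
  open import Data.Nat.Solver using (module +-*-Solver)
  open +-*-Solver
  open import Algebra.Properties.CommutativeSemigroup +-commutativeSemigroup using (interchange)
  open import Algebra.Properties.CommutativeSemigroup *-commutativeSemigroup using (x∙yz≈y∙xz)

  sumUpTo : (ℕ → ℕ) → ℕ → ℕ
  sumUpTo f zero    = f zero
  sumUpTo f (suc m) = f (suc m) + sumUpTo f m

  sumUpTo-cong : ∀ {f g} m → (∀ k → f k ≡ g k) → sumUpTo f m ≡ sumUpTo g m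
  sumUpTo-cong zero    f≗g = f≗g zero
  sumUpTo-cong (suc m) f≗g = cong₂ _+_ (f≗g (suc m)) (sumUpTo-cong m f≗g)

  sumUpTo-+ : ∀ f g m → sumUpTo (λ k → f k + g k) m ≡ sumUpTo f m + sumUpTo g m
  sumUpTo-+ f g zero    = refl
  sumUpTo-+ f g (suc m) = trans (cong (f (suc m) + g (suc m) +_) (sumUpTo-+ f g m)) (interchange (f (suc m)) (g (suc m)) _ _)

  *-sumUpTo : ∀ c f m → c * sumUpTo f m ≡ sumUpTo (λ k → c * f k) m
  *-sumUpTo c f zero    = refl
  *-sumUpTo c f (suc m) = trans (*-distribˡ-+ c (f (suc m)) (sumUpTo f m)) (cong (c * f (suc m) +_) (*-sumUpTo c f m))

  sumUpTo-shift : ∀ f m → sumUpTo f (suc m) ≡ sumUpTo (λ k → f (suc k)) m + f zero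
  sumUpTo-shift f zero    = refl
  sumUpTo-shift f (suc m) = trans (cong (f (2 + m) +_) (sumUpTo-shift f m)) (sym (+-assoc (f (2 + m)) _ (f zero)))

  sum-sumUpTo : {A : Set} (h : A → ℕ → ℕ) (xs : List A) (m : ℕ) →
    sum (map (λ x → sumUpTo (h x) m) xs) ≡ sumUpTo (λ k → sum (map (λ x → h x k) xs)) m
  sum-sumUpTo h []       zero    = refl
  sum-sumUpTo h []       (suc m) = sum-sumUpTo h [] m
  sum-sumUpTo h (x ∷ xs) m       = trans (cong (sumUpTo (h x) m +_) (sum-sumUpTo h xs m)) (sym (sumUpTo-+ _ _ m))

  stirling2-vanish : ∀ ℓ k → stirling2 ℓ (suc ℓ + k) ≡ 0
  stirling2-vanish zero    k = refl
  stirling2-vanish (suc ℓ) k = begin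
    suc (suc ℓ + k) * stirling2 ℓ (suc (suc ℓ + k)) + stirling2 ℓ (suc ℓ + k)
      ≡⟨ cong (λ j → suc (suc ℓ + k) * stirling2 ℓ (suc j) + stirling2 ℓ (suc ℓ + k)) (+-suc ℓ k) ⟨
    suc (suc ℓ + k) * stirling2 ℓ (suc ℓ + suc k) + stirling2 ℓ (suc ℓ + k)
      ≡⟨ cong₂ (λ x y → suc (suc ℓ + k) * x + y) (stirling2-vanish ℓ (suc k)) (stirling2-vanish ℓ k) ⟩
    suc (suc ℓ + k) * 0 + 0
      ≡⟨ cong (_+ 0) (*-zeroʳ (suc (suc ℓ + k))) ⟩
    0 ∎
    where open ≡-Reasoning

  -- Multiplying by s raises the falling factorial (s)ₖ to (s)ₖ₊₁ + k (s)ₖ, which is the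
  -- Stirling recursion read off coefficientwise.
  ^≡stirling2-falling : ∀ s ℓ → s ^ ℓ ≡ sumUpTo (λ k → stirling2 ℓ k * falling s k) ℓ
  ^≡stirling2-falling s zero    = refl
  ^≡stirling2-falling s (suc ℓ) = begin
    s * s ^ ℓ
      ≡⟨ cong (s *_) (^≡stirling2-falling s ℓ) ⟩
    s * sumUpTo (λ k → S k * falling s k) ℓ
      ≡⟨ *-sumUpTo s _ ℓ ⟩
    sumUpTo (λ k → s * (S k * falling s k)) ℓ
      ≡⟨ sumUpTo-cong ℓ raise ⟩
    sumUpTo (λ k → S k * falling s (suc k) + g k) ℓ
      ≡⟨ sumUpTo-+ _ g ℓ ⟩
    sumUpTo (λ k → S k * falling s (suc k)) ℓ + sumUpTo g ℓ
      ≡⟨ cong (sumUpTo (λ k → S k * falling s (suc k)) ℓ +_) g-shift ⟩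
    sumUpTo (λ k → S k * falling s (suc k)) ℓ + sumUpTo (λ k → g (suc k)) ℓ
      ≡⟨ sumUpTo-+ _ _ ℓ ⟨
    sumUpTo (λ k → S k * falling s (suc k) + g (suc k)) ℓ
      ≡⟨ sumUpTo-cong ℓ (λ k → collect (S k) (S (suc k)) k (falling s (suc k))) ⟩
    sumUpTo (λ k → stirling2 (suc ℓ) (suc k) * falling s (suc k)) ℓ
      ≡⟨ +-identityʳ _ ⟨
    sumUpTo (λ k → stirling2 (suc ℓ) (suc k) * falling s (suc k)) ℓ + 0
      ≡⟨ sumUpTo-shift (λ k → stirling2 (suc ℓ) k * falling s k) ℓ ⟨
    sumUpTo (λ k → stirling2 (suc ℓ) k * falling s k) (suc ℓ) ∎
    where
    open ≡-Reasoning
    S = stirling2 ℓ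
    g : ℕ → ℕ
    g k = S k * (k * falling s k)
    raise : ∀ k → s * (S k * falling s k) ≡ S k * falling s (suc k) + g k
    raise k = trans (x∙yz≈y∙xz s (S k) (falling s k))
                    (trans (cong (S k *_) (*-falling s k)) (*-distribˡ-+ (S k) _ _))
    collect : ∀ a b k f → a * f + b * (suc k * f) ≡ (suc k * b + a) * f
    collect = solve 4 (λ a b k f → a :* f :+ b :* ((con 1 :+ k) :* f) := ((con 1 :+ k) :* b :+ a) :* f) refl
    g-shift : sumUpTo g ℓ ≡ sumUpTo (λ k → g (suc k)) ℓ
    g-shift = begin
      sumUpTo g ℓ
        ≡⟨ cong (λ x → x * (suc ℓ * falling s (suc ℓ)) + sumUpTo g ℓ)
                (trans (cong S (cong suc (sym (+-identityʳ ℓ)))) (stirling2-vanish ℓ 0)) ⟨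
      g (suc ℓ) + sumUpTo g ℓ
        ≡⟨ sumUpTo-shift g ℓ ⟩
      sumUpTo (λ k → g (suc k)) ℓ + S 0 * 0
        ≡⟨ cong (sumUpTo (λ k → g (suc k)) ℓ +_) (*-zeroʳ (S 0)) ⟩
      sumUpTo (λ k → g (suc k)) ℓ + 0
        ≡⟨ +-identityʳ _ ⟩
      sumUpTo (λ k → g (suc k)) ℓ ∎

module LoopTuples where

  open import Data.Nat using (ℕ; zero; suc; _+_; _*_; _∸_; pred)
  open import Data.Nat.Properties
  open import Relation.Binary.PropositionalEquality
  open import Data.Nat.Solver using (module +-*-Solver)
  open +-*-Solver
  open import Algebra.Properties.CommutativeSemigroup *-commutativeSemigroup using (x∙yz≈y∙xz)

  choose2 : ℕ → ℕ
  choose2 zero    = 0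
  choose2 (suc n) = n + choose2 n

  -- (N - 1)!! for even N and 0 for odd N: the number of perfect matchings of N points.
  matchingCount : ℕ → ℕ
  matchingCount zero          = 1
  matchingCount (suc zero)    = 0
  matchingCount (suc (suc n)) = suc n * matchingCount n

  -- Number of pairs (perfect matching, ordered k-tuple of distinct loops) on a points
  -- of one colour and b of another, a loop being a matched pair of the first colour:
  -- the first loop is one of choose2 a pairs, the rest lives on the other a - 2 + b points.
  loopTuples : ℕ → ℕ → ℕ → ℕ
  loopTuples a             b zero    = matchingCount (a + b)
  loopTuples zero          b (suc k) = 0
  loopTuples (suc zero)    b (suc k) = 0
  loopTuples (suc (suc a)) b (suc k) = choose2 (2 + a) * loopTuples a b k

  2*choose2 : ∀ n → 2 * choose2 n ≡ n * (n ∸ 1)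
  2*choose2 zero          = refl
  2*choose2 (suc zero)    = refl
  2*choose2 (suc (suc n)) = begin
    2 * (suc n + choose2 (suc n))       ≡⟨ *-distribˡ-+ 2 (suc n) (choose2 (suc n)) ⟩
    2 * suc n + 2 * choose2 (suc n)     ≡⟨ cong (2 * suc n +_) (2*choose2 (suc n)) ⟩
    2 * suc n + suc n * n               ≡⟨ solve 1 (λ n → con 2 :* (con 1 :+ n) :+ (con 1 :+ n) :* n
                                                         := (con 2 :+ n) :* (con 1 :+ n)) refl n ⟩
    suc (suc n) * suc n                 ∎
    where open ≡-Reasoning

  choose2-shift : ∀ m → choose2 (3 + m) * (1 + m) ≡ (3 + m) * choose2 (2 + m)
  choose2-shift m = *-cancelˡ-≡ _ _ 2 (begin
    2 * (choose2 (3 + m) * (1 + m))     ≡⟨ *-assoc 2 (choose2 (3 + m)) (1 + m) ⟨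
    2 * choose2 (3 + m) * (1 + m)       ≡⟨ cong (_* (1 + m)) (2*choose2 (3 + m)) ⟩
    (3 + m) * (2 + m) * (1 + m)         ≡⟨ *-assoc (3 + m) (2 + m) (1 + m) ⟩
    (3 + m) * ((2 + m) * (1 + m))       ≡⟨ cong ((3 + m) *_) (2*choose2 (2 + m)) ⟨
    (3 + m) * (2 * choose2 (2 + m))     ≡⟨ x∙yz≈y∙xz (3 + m) 2 (choose2 (2 + m)) ⟩
    2 * ((3 + m) * choose2 (2 + m))     ∎)
    where open ≡-Reasoning

  loopTuples-absorb : ∀ a b k →
    a * (choose2 (2 + a) * loopTuples (a ∸ 1) b k) ≡ (2 + a) * loopTuples (suc a) b (suc k)
  loopTuples-absorb zero    b k = refl
  loopTuples-absorb (suc m) b k = begin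
    suc m * (choose2 (3 + m) * G)     ≡⟨ x∙yz≈y∙xz (suc m) (choose2 (3 + m)) G ⟩
    choose2 (3 + m) * (suc m * G)     ≡⟨ *-assoc (choose2 (3 + m)) (suc m) G ⟨
    choose2 (3 + m) * suc m * G       ≡⟨ cong (_* G) (choose2-shift m) ⟩
    (3 + m) * choose2 (2 + m) * G     ≡⟨ *-assoc (3 + m) (choose2 (2 + m)) G ⟩
    (3 + m) * (choose2 (2 + m) * G)   ∎
    where
    open ≡-Reasoning
    G = loopTuples m b k

  -- Pairing the first point, of the second colour (resp. of the first colour), with
  -- each of the other points in turn.
  loopTuples-first-off : ∀ a b k →
    loopTuples a (suc b) k ≡ a * loopTuples (a ∸ 1) b k + b * loopTuples a (b ∸ 1) k
  loopTuples-first-off zero          zero    zero    = refl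
  loopTuples-first-off zero          (suc b) zero    = refl
  loopTuples-first-off (suc a)       b       zero    = begin
    matchingCount (suc a + suc b)                               ≡⟨ cong matchingCount (cong suc (+-suc a b)) ⟩
    suc (a + b) * matchingCount (a + b)                         ≡⟨ *-distribʳ-+ (matchingCount (a + b)) (suc a) b ⟩
    suc a * matchingCount (a + b) + b * matchingCount (a + b)   ≡⟨ cong (suc a * matchingCount (a + b) +_) (lower b) ⟩
    suc a * matchingCount (a + b) + b * matchingCount (suc a + (b ∸ 1)) ∎
    where
    open ≡-Reasoning
    lower : ∀ b → b * matchingCount (a + b) ≡ b * matchingCount (suc a + (b ∸ 1))
    lower zero    = refl
    lower (suc b) = cong (λ m → suc b * matchingCount m) (+-suc a b)
  loopTuples-first-off zero          b       (suc k) = sym (*-zeroʳ b)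
  loopTuples-first-off (suc zero)    b       (suc k) = sym (*-zeroʳ b)
  loopTuples-first-off (suc (suc a)) b       (suc k) = begin
    t * loopTuples a (suc b) k                          ≡⟨ cong (t *_) (loopTuples-first-off a b k) ⟩
    t * (a * G₁ + b * G₂)                               ≡⟨ solve 5 (λ t a x b y → t :* (a :* x :+ b :* y) := a :* (t :* x) :+ b :* (t :* y))
                                                                  refl t a G₁ b G₂ ⟩
    a * (t * G₁) + b * (t * G₂)                         ≡⟨ cong (_+ b * (t * G₂)) (loopTuples-absorb a b k) ⟩
    (2 + a) * loopTuples (suc a) b (suc k) + b * (t * G₂) ∎
    where
    open ≡-Reasoning
    t  = choose2 (2 + a)
    G₁ = loopTuples (a ∸ 1) b k
    G₂ = loopTuples a (b ∸ 1) k

  loopTuples-swap : ∀ a b k →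
    loopTuples (suc a) b (suc k) ≡ loopTuples a (suc b) (suc k) + a * suc k * loopTuples (a ∸ 1) b k
  loopTuples-swap zero          b k       = refl
  loopTuples-swap (suc zero)    b zero    = refl
  loopTuples-swap (suc zero)    b (suc k) = sym (*-zeroʳ (1 * suc (suc k)))
  loopTuples-swap (suc (suc a)) b zero    = begin
    choose2 (3 + a) * matchingCount (suc a + b)                ≡⟨ cong (λ m → choose2 (3 + a) * matchingCount m) (+-suc a b) ⟨
    (2 + a + t) * M                                             ≡⟨ solve 3 (λ a t x → ((con 2 :+ a) :+ t) :* x := t :* x :+ (con 2 :+ a) :* con 1 :* x)
                                                                         refl a t M ⟩
    t * M + (2 + a) * 1 * M                                     ≡⟨ cong (λ m → t * M + (2 + a) * 1 * matchingCount m) (+-suc a b) ⟩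
    t * M + (2 + a) * 1 * matchingCount (suc a + b)             ∎
    where
    open ≡-Reasoning
    t = choose2 (2 + a)
    M = matchingCount (a + suc b)
  loopTuples-swap (suc (suc a)) b (suc k) = begin
    (2 + a + t) * X                                 ≡⟨ solve 3 (λ a t x → ((con 2 :+ a) :+ t) :* x := (con 2 :+ a) :* x :+ t :* x) refl a t X ⟩
    (2 + a) * X + t * X                             ≡⟨ cong (λ y → (2 + a) * X + t * y) (loopTuples-swap a b k) ⟩
    (2 + a) * X + t * (Y + a * suc k * Z)           ≡⟨ solve 6 (λ a x t y k z → (con 2 :+ a) :* x :+ t :* (y :+ a :* (con 1 :+ k) :* z)
                                                                 := t :* y :+ (con 2 :+ a) :* x :+ (con 1 :+ k) :* (a :* (t :* z)))
                                                              refl a X t Y k Z ⟩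
    t * Y + (2 + a) * X + suc k * (a * (t * Z))     ≡⟨ cong (λ y → t * Y + (2 + a) * X + suc k * y) (loopTuples-absorb a b k) ⟩
    t * Y + (2 + a) * X + suc k * ((2 + a) * X)     ≡⟨ solve 5 (λ t y a x k → t :* y :+ (con 2 :+ a) :* x :+ (con 1 :+ k) :* ((con 2 :+ a) :* x)
                                                                 := t :* y :+ (con 2 :+ a) :* (con 2 :+ k) :* x)
                                                              refl t Y a X k ⟩
    t * Y + (2 + a) * suc (suc k) * X               ∎
    where
    open ≡-Reasoning
    t = choose2 (2 + a)
    X = loopTuples (suc a) b (suc k)
    Y = loopTuples a (suc b) (suc k)
    Z = loopTuples (a ∸ 1) b k

  loopTuples-first-on : ∀ a b k →
    loopTuples (suc a) b k ≡ a * (loopTuples (a ∸ 1) b k + k * loopTuples (a ∸ 1) b (pred k)) + b * loopTuples a (b ∸ 1) k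
  loopTuples-first-on a b zero    = begin
    matchingCount (suc a + b)                        ≡⟨ cong matchingCount (+-suc a b) ⟨
    loopTuples a (suc b) zero                        ≡⟨ loopTuples-first-off a b zero ⟩
    a * G + b * loopTuples a (b ∸ 1) zero            ≡⟨ cong (λ x → a * x + b * loopTuples a (b ∸ 1) zero) (+-identityʳ G) ⟨
    a * (G + 0) + b * loopTuples a (b ∸ 1) zero      ∎
    where
    open ≡-Reasoning
    G = loopTuples (a ∸ 1) b zero
  loopTuples-first-on a b (suc k) = begin
    loopTuples (suc a) b (suc k)                     ≡⟨ loopTuples-swap a b k ⟩
    loopTuples a (suc b) (suc k) + a * suc k * Z     ≡⟨ cong (_+ a * suc k * Z) (loopTuples-first-off a b (suc k)) ⟩
    a * X + b * Y + a * suc k * Z                    ≡⟨ solve 6 (λ a x b y k z → a :* x :+ b :* y :+ a :* k :* z := a :* (x :+ k :* z) :+ b :* y)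
                                                              refl a X b Y (suc k) Z ⟩
    a * (X + suc k * Z) + b * Y                      ∎
    where
    open ≡-Reasoning
    X = loopTuples (a ∸ 1) b (suc k)
    Y = loopTuples a (b ∸ 1) (suc k)
    Z = loopTuples (a ∸ 1) b k

module MatchingCounts where

  open import Defs
  open LoopTuples
  open ListSums
  open FallingFactorial
  open import Data.Nat using (ℕ; zero; suc; _+_; _*_; _∸_; pred; _≤_; s≤s)
  open import Data.Nat.Properties using (+-assoc; +-identityʳ; n≤1+n; ≤-refl; ≤-trans; ≤-reflexive; +-commutativeSemigroup)
  open import Data.Nat.ListAction using (sum)
  open import Data.List using (List; []; _∷_; length; map)
  open import Data.List.Properties using (map-∘; map-cong; map-cong-local)
  open import Data.List.Relation.Unary.All as All using (All; []; _∷_)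
  open import Data.List.Relation.Unary.All.Properties using (map⁺)
  open import Data.Product using (_×_; _,_)
  open import Data.Bool using (Bool; true; false; not; if_then_else_)
  open import Data.Fin using (Fin; _≟_)
  open import Relation.Nullary.Decidable using (does)
  open import Relation.Binary.PropositionalEquality
  open import Algebra.Properties.CommutativeSemigroup +-commutativeSemigroup using (x∙yz≈y∙xz)

  χ : Bool → ℕ
  χ true  = 1
  χ false = 0

  *-suc-∸1 : ∀ c (f : ℕ → ℕ) → c * f (suc (c ∸ 1)) ≡ c * f c
  *-suc-∸1 zero    f = refl
  *-suc-∸1 (suc c) f = refl

  module _ {n : ℕ} (i : Fin n) where

    atSite : Fin n → Bool
    atSite y = does (y ≟ i)

    #at #off : List (Fin n) → ℕ
    #at []        = 0
    #at (y ∷ ys)  = χ (atSite y) + #at ys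
    #off []       = 0
    #off (y ∷ ys) = χ (not (atSite y)) + #off ys

    picks-length : (xs : List (Fin n)) → All (λ (_ , rest) → suc (length rest) ≡ length xs) (picks xs)
    picks-length []       = []
    picks-length (x ∷ xs) = refl ∷ map⁺ (All.map (cong suc) (picks-length xs))

    sum-picks : (W : Bool → ℕ → ℕ → ℕ) (xs : List (Fin n)) →
      sum (map (λ (y , rest) → W (atSite y) (#at rest) (#off rest)) (picks xs))
        ≡ #at xs * W true (#at xs ∸ 1) (#off xs) + #off xs * W false (#at xs) (#off xs ∸ 1)
    sum-picks W []       = refl
    sum-picks W (x ∷ xs) = begin
      W (atSite x) c o + sum (map V (map (λ (y , rest) → y , x ∷ rest) (picks xs)))
        ≡⟨ cong (λ s → W (atSite x) c o + sum s) (map-∘ (picks xs)) ⟨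
      W (atSite x) c o + sum (map (λ (y , rest) → W (atSite y) (χ (atSite x) + #at rest) (χ (not (atSite x)) + #off rest)) (picks xs))
        ≡⟨ cong (W (atSite x) c o +_) (sum-picks (λ b p q → W b (χ (atSite x) + p) (χ (not (atSite x)) + q)) xs) ⟩
      W (atSite x) c o + (c * W true (χ (atSite x) + (c ∸ 1)) (χ (not (atSite x)) + o)
                          + o * W false (χ (atSite x) + c) (χ (not (atSite x)) + (o ∸ 1)))
        ≡⟨ insert (atSite x) ⟩
      (χ (atSite x) + c) * W true (χ (atSite x) + c ∸ 1) (χ (not (atSite x)) + o)
        + (χ (not (atSite x)) + o) * W false (χ (atSite x) + c) (χ (not (atSite x)) + o ∸ 1) ∎
      where
      open ≡-Reasoning
      c = #at xs
      o = #off xs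
      V : Fin n × List (Fin n) → ℕ
      V (y , rest) = W (atSite y) (#at rest) (#off rest)
      insert : ∀ b → W b c o + (c * W true (χ b + (c ∸ 1)) (χ (not b) + o) + o * W false (χ b + c) (χ (not b) + (o ∸ 1)))
                   ≡ (χ b + c) * W true (χ b + c ∸ 1) (χ (not b) + o) + (χ (not b) + o) * W false (χ b + c) (χ (not b) + o ∸ 1)
      insert true  = begin
        W true c o + (c * W true (suc (c ∸ 1)) o + o * W false (suc c) (o ∸ 1))
          ≡⟨ cong (λ s → W true c o + (s + o * W false (suc c) (o ∸ 1))) (*-suc-∸1 c (λ p → W true p o)) ⟩
        W true c o + (c * W true c o + o * W false (suc c) (o ∸ 1))
          ≡⟨ +-assoc (W true c o) _ _ ⟨
        suc c * W true c o + o * W false (suc c) (o ∸ 1) ∎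
      insert false = begin
        W false c o + (c * W true (c ∸ 1) (suc o) + o * W false c (suc (o ∸ 1)))
          ≡⟨ cong (λ s → W false c o + (c * W true (c ∸ 1) (suc o) + s)) (*-suc-∸1 o (W false c)) ⟩
        W false c o + (c * W true (c ∸ 1) (suc o) + o * W false c o)
          ≡⟨ x∙yz≈y∙xz (W false c o) (c * W true (c ∸ 1) (suc o)) (o * W false c o) ⟩
        c * W true (c ∸ 1) (suc o) + (W false c o + o * W false c o) ∎

    loopFallingSum : List (List (Fin n × Fin n)) → ℕ → ℕ
    loopFallingSum ms k = sum (map (λ m → falling (loopsAt i m) k) ms)

    -- Σ (loops)ₖ over the matchings of the other points (counts a and b) extended by a pair
    -- x y; the flags are atSite x and atSite y, and x y is itself a loop iff both hold.
    pairedSum : Bool → Bool → ℕ → ℕ → ℕ → ℕ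
    pairedSum true  true  a b k = loopTuples a b k + k * loopTuples a b (pred k)
    pairedSum true  false a b k = loopTuples a b k
    pairedSum false _     a b k = loopTuples a b k

    loopFallingSum-suc : ∀ ms k →
      sum (map (λ m → falling (suc (loopsAt i m)) (suc k)) ms) ≡ loopFallingSum ms (suc k) + suc k * loopFallingSum ms k
    loopFallingSum-suc ms k = begin
      sum (map (λ m → falling (suc (loopsAt i m)) (suc k)) ms)
        ≡⟨ cong sum (map-cong (λ m → falling-suc (loopsAt i m) k) ms) ⟩
      sum (map (λ m → falling (loopsAt i m) (suc k) + suc k * falling (loopsAt i m) k) ms)
        ≡⟨ sum-map-+ _ _ ms ⟩
      loopFallingSum ms (suc k) + sum (map (λ m → suc k * falling (loopsAt i m) k) ms)
        ≡⟨ cong (loopFallingSum ms (suc k) +_) (sum-map-*ˡ (suc k) _ ms) ⟩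
      loopFallingSum ms (suc k) + suc k * loopFallingSum ms k ∎
      where open ≡-Reasoning

    loopFallingSum-pair : ∀ bx by ms a b k → (∀ k → loopFallingSum ms k ≡ loopTuples a b k) →
      sum (map (λ m → falling ((if bx then (if by then 1 else 0) else 0) + loopsAt i m) k) ms) ≡ pairedSum bx by a b k
    loopFallingSum-pair true  true  ms a b zero    hyp = trans (hyp zero) (sym (+-identityʳ _))
    loopFallingSum-pair true  true  ms a b (suc k) hyp =
      trans (loopFallingSum-suc ms k) (cong₂ (λ x y → x + suc k * y) (hyp (suc k)) (hyp k))
    loopFallingSum-pair true  false ms a b k       hyp = hyp k
    loopFallingSum-pair false by    ms a b k       hyp = hyp k

    loopTuples-first : ∀ bx c o k →
      c * pairedSum bx true (c ∸ 1) o k + o * pairedSum bx false c (o ∸ 1) k ≡ loopTuples (χ bx + c) (χ (not bx) + o) k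
    loopTuples-first true  c o k = sym (loopTuples-first-on c o k)
    loopTuples-first false c o k = sym (loopTuples-first-off c o k)

    loopFallingSum-matchingsF : ∀ f L → length L ≤ f → ∀ k →
      loopFallingSum (matchingsF f L) k ≡ loopTuples (#at L) (#off L) k
    loopFallingSum-matchingsF f       []       _         zero    = refl
    loopFallingSum-matchingsF f       []       _         (suc k) = refl
    loopFallingSum-matchingsF (suc f) (x ∷ xs) (s≤s len) k       = begin
      loopFallingSum (matchingsF (suc f) (x ∷ xs)) k
        ≡⟨ sum-concatMap _ _ (picks xs) ⟩
      sum (map (λ (y , rest) → sum (map F (map ((x , y) ∷_) (matchingsF f rest)))) (picks xs))
        ≡⟨ cong sum (map-cong-local (All.map (λ {p} → pair p) (picks-length xs))) ⟩
      sum (map (λ (y , rest) → pairedSum (atSite x) (atSite y) (#at rest) (#off rest) k) (picks xs))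
        ≡⟨ sum-picks (λ b p q → pairedSum (atSite x) b p q k) xs ⟩
      #at xs * pairedSum (atSite x) true (#at xs ∸ 1) (#off xs) k + #off xs * pairedSum (atSite x) false (#at xs) (#off xs ∸ 1) k
        ≡⟨ loopTuples-first (atSite x) (#at xs) (#off xs) k ⟩
      loopTuples (#at (x ∷ xs)) (#off (x ∷ xs)) k ∎
      where
      open ≡-Reasoning
      F : List (Fin n × Fin n) → ℕ
      F m = falling (loopsAt i m) k
      pair : ((y , rest) : Fin n × List (Fin n)) → suc (length rest) ≡ length xs →
        sum (map F (map ((x , y) ∷_) (matchingsF f rest))) ≡ pairedSum (atSite x) (atSite y) (#at rest) (#off rest) k
      pair (y , rest) len-rest = trans (cong sum (sym (map-∘ (matchingsF f rest))))
        (loopFallingSum-pair (atSite x) (atSite y) (matchingsF f rest) (#at rest) (#off rest) k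
          (loopFallingSum-matchingsF f rest (≤-trans (n≤1+n (length rest)) (≤-trans (≤-reflexive len-rest) len))))

    loopFallingSum-matchings : ∀ L k → loopFallingSum (matchings L) k ≡ loopTuples (#at L) (#off L) k
    loopFallingSum-matchings L = loopFallingSum-matchingsF (length L) L ≤-refl

module LoopTupleBounds where

  open LoopTuples
  open import Data.Nat using (ℕ; zero; suc; _+_; _*_; _∸_; _^_; _≤_; _<_; s≤s; z≤n)
  open import Data.Nat.Properties
  open import Data.Product using (_,_)
  open import Relation.Binary.PropositionalEquality
  open import Data.Nat.Solver using (module +-*-Solver)
  open +-*-Solver

  double : ℕ → ℕ
  double zero    = 0
  double (suc k) = suc (suc (double k))

  orderedPairings : ℕ → ℕ → ℕ
  orderedPairings a             zero    = 1
  orderedPairings zero          (suc k) = 0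
  orderedPairings (suc zero)    (suc k) = 0
  orderedPairings (suc (suc a)) (suc k) = choose2 (2 + a) * orderedPairings a k

  oddFalling : ℕ → ℕ → ℕ
  oddFalling N zero    = 1
  oddFalling N (suc k) = (N ∸ 1) * oddFalling (N ∸ 2) k

  loopTuples-factor : ∀ k a b r → a + b ≡ double k + r → loopTuples a b k ≡ orderedPairings a k * matchingCount r
  loopTuples-factor zero    a             b r eq = trans (cong matchingCount eq) (sym (+-identityʳ _))
  loopTuples-factor (suc k) zero          b r eq = refl
  loopTuples-factor (suc k) (suc zero)    b r eq = refl
  loopTuples-factor (suc k) (suc (suc a)) b r eq =
    trans (cong (choose2 (2 + a) *_) (loopTuples-factor k a b r (suc-injective (suc-injective eq))))
          (sym (*-assoc (choose2 (2 + a)) (orderedPairings a k) (matchingCount r)))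

  matchingCount-factor : ∀ k r → matchingCount (double k + r) ≡ oddFalling (double k + r) k * matchingCount r
  matchingCount-factor zero    r = sym (+-identityʳ _)
  matchingCount-factor (suc k) r =
    trans (cong (suc (double k + r) *_) (matchingCount-factor k r)) (sym (*-assoc (suc (double k + r)) (oddFalling (double k + r) k) (matchingCount r)))

  loopTuples-vanish : ∀ k a b → a + b < double k → loopTuples a b k ≡ 0
  loopTuples-vanish (suc k) zero          b _               = refl
  loopTuples-vanish (suc k) (suc zero)    b _               = refl
  loopTuples-vanish (suc k) (suc (suc a)) b (s≤s (s≤s a+b<)) =
    trans (cong (choose2 (2 + a) *_) (loopTuples-vanish k a b a+b<)) (*-zeroʳ (choose2 (2 + a)))

  ^-distribʳ-* : ∀ m n k → (m * n) ^ k ≡ m ^ k * n ^ k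
  ^-distribʳ-* m n zero    = refl
  ^-distribʳ-* m n (suc k) = trans (cong (m * n *_) (^-distribʳ-* m n k))
    (solve 4 (λ m n x y → m :* n :* (x :* y) := m :* x :* (n :* y)) refl m n (m ^ k) (n ^ k))

  ^-suc-+-≤ : ∀ k x δ → (x + δ) ^ suc k ≤ x ^ suc k + suc k * δ * (x + δ) ^ k
  ^-suc-+-≤ zero    x δ = ≤-reflexive (solve 2 (λ x δ → (x :+ δ) :* con 1 := x :* con 1 :+ con 1 :* δ :* con 1) refl x δ)
  ^-suc-+-≤ (suc k) x δ = begin
    y * y ^ suc k
      ≤⟨ *-monoʳ-≤ y (^-suc-+-≤ k x δ) ⟩
    y * (x ^ suc k + suc k * δ * y ^ k)
      ≡⟨ solve 5 (λ x δ a k b → (x :+ δ) :* (a :+ (con 1 :+ k) :* δ :* b)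
                               := x :* a :+ δ :* a :+ (con 1 :+ k) :* δ :* ((x :+ δ) :* b))
                 refl x δ (x ^ suc k) k (y ^ k) ⟩
    x * x ^ suc k + δ * x ^ suc k + suc k * δ * y ^ suc k
      ≤⟨ +-monoˡ-≤ _ (+-monoʳ-≤ (x * x ^ suc k) (*-monoʳ-≤ δ (^-monoˡ-≤ (suc k) (m≤m+n x δ)))) ⟩
    x * x ^ suc k + δ * y ^ suc k + suc k * δ * y ^ suc k
      ≡⟨ solve 4 (λ a δ b k → a :+ δ :* b :+ (con 1 :+ k) :* δ :* b := a :+ (con 2 :+ k) :* δ :* b)
                 refl (x * x ^ suc k) δ (y ^ suc k) k ⟩
    x ^ suc (suc k) + suc (suc k) * δ * y ^ suc k ∎
    where
    open ≤-Reasoning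
    y = x + δ

  choose2-mono : ∀ a → choose2 a ≤ choose2 (2 + a)
  choose2-mono a = ≤-trans (m≤n+m (choose2 a) a) (m≤n+m (a + choose2 a) (suc a))

  choose2≤square : ∀ a → choose2 a ≤ a * a
  choose2≤square zero    = z≤n
  choose2≤square (suc a) = begin
    a + choose2 a                ≤⟨ +-monoʳ-≤ a (choose2≤square a) ⟩
    a + a * a                    ≤⟨ m≤n+m (a + a * a) (suc a) ⟩
    suc a + (a + a * a)          ≡⟨ solve 1 (λ a → (con 1 :+ a) :+ (a :+ a :* a) := (con 1 :+ a) :* (con 1 :+ a)) refl a ⟩
    suc a * suc a                ∎
    where open ≤-Reasoning

  orderedPairings≤choose2^ : ∀ a k → orderedPairings a k ≤ choose2 a ^ k
  orderedPairings≤choose2^ a             zero    = ≤-refl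
  orderedPairings≤choose2^ zero          (suc k) = z≤n
  orderedPairings≤choose2^ (suc zero)    (suc k) = z≤n
  orderedPairings≤choose2^ (suc (suc a)) (suc k) =
    *-monoʳ-≤ (choose2 (2 + a)) (≤-trans (orderedPairings≤choose2^ a k) (^-monoˡ-≤ k (choose2-mono a)))

  -- Passing from a to a + 2 points raises choose2 by δ = 2a + 1, and ^-suc-+-≤ charges
  -- that increase to the correction term.
  choose2^≤orderedPairings : ∀ k a →
    choose2 a ^ suc k ≤ orderedPairings a (suc k) + suc k * k * a * choose2 a ^ k
  choose2^≤orderedPairings k       zero          = z≤n
  choose2^≤orderedPairings k       (suc zero)    = z≤n
  choose2^≤orderedPairings zero    (suc (suc a)) = ≤-reflexive (sym (+-identityʳ _))
  choose2^≤orderedPairings (suc k) (suc (suc a)) = begin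
    t * t ^ suc k
      ≡⟨ cong (λ s → t * s ^ suc k) t≡t′+δ ⟩
    t * (t′ + δ) ^ suc k
      ≤⟨ *-monoʳ-≤ t (^-suc-+-≤ k t′ δ) ⟩
    t * (t′ ^ suc k + suc k * δ * (t′ + δ) ^ k)
      ≤⟨ *-monoʳ-≤ t (+-monoˡ-≤ _ (choose2^≤orderedPairings k a)) ⟩
    t * (Q + suc k * k * a * t′ ^ k + suc k * δ * (t′ + δ) ^ k)
      ≡⟨ cong (λ s → t * (Q + suc k * k * a * t′ ^ k + suc k * δ * s ^ k)) t≡t′+δ ⟨
    t * (Q + suc k * k * a * t′ ^ k + suc k * δ * t ^ k)
      ≤⟨ *-monoʳ-≤ t (+-monoˡ-≤ _ (+-monoʳ-≤ Q (*-monoʳ-≤ (suc k * k * a) (^-monoˡ-≤ k (choose2-mono a))))) ⟩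
    t * (Q + suc k * k * a * t ^ k + suc k * δ * t ^ k)
      ≡⟨ solve 6 (λ t q k a x δ → t :* (q :+ (con 1 :+ k) :* k :* a :* x :+ (con 1 :+ k) :* δ :* x)
                                 := t :* q :+ (con 1 :+ k) :* (k :* a :+ δ) :* (t :* x))
                 refl t Q k a (t ^ k) δ ⟩
    t * Q + suc k * (k * a + δ) * (t * t ^ k)
      ≤⟨ +-monoʳ-≤ (t * Q) (*-monoˡ-≤ (t * t ^ k) (*-monoʳ-≤ (suc k) ka+δ≤)) ⟩
    t * Q + suc k * ((2 + k) * (2 + a)) * (t * t ^ k)
      ≡⟨ cong (t * Q +_) (solve 4 (λ k a t x → (con 1 :+ k) :* ((con 2 :+ k) :* (con 2 :+ a)) :* (t :* x)
                                              := (con 2 :+ k) :* (con 1 :+ k) :* (con 2 :+ a) :* (t :* x))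
                                  refl k a t (t ^ k)) ⟩
    t * Q + suc (suc k) * suc k * suc (suc a) * (t * t ^ k) ∎
    where
    open ≤-Reasoning
    t  = choose2 (2 + a)
    t′ = choose2 a
    δ  = suc a + a
    Q  = orderedPairings a (suc k)
    t≡t′+δ : t ≡ t′ + δ
    t≡t′+δ = solve 2 (λ a x → con 1 :+ a :+ (a :+ x) := x :+ (con 1 :+ a :+ a)) refl a t′
    ka+δ≤ : k * a + δ ≤ (2 + k) * (2 + a)
    ka+δ≤ = begin
      k * a + δ                      ≡⟨ solve 2 (λ k a → k :* a :+ (con 1 :+ a :+ a) := con 1 :+ (con 2 :+ k) :* a) refl k a ⟩
      1 + (2 + k) * a                ≤⟨ m≤n+m (1 + (2 + k) * a) (2 * k + 3) ⟩
      2 * k + 3 + (1 + (2 + k) * a)  ≡⟨ solve 2 (λ k a → con 2 :* k :+ con 3 :+ (con 1 :+ (con 2 :+ k) :* a)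
                                                         := (con 2 :+ k) :* (con 2 :+ a)) refl k a ⟩
      (2 + k) * (2 + a)              ∎

  oddFalling≤^ : ∀ N k → oddFalling N k ≤ N ^ k
  oddFalling≤^ N zero    = ≤-refl
  oddFalling≤^ N (suc k) = *-mono-≤ (m∸n≤m N 1) (≤-trans (oddFalling≤^ (N ∸ 2) k) (^-monoˡ-≤ k (m∸n≤m N 2)))

  ^≤oddFalling : ∀ k N → N ^ suc k ≤ oddFalling N (suc k) + suc k * suc k * N ^ k
  ^≤oddFalling zero    zero          = z≤n
  ^≤oddFalling zero    (suc N)       = ≤-reflexive (solve 1 (λ N → (con 1 :+ N) :* con 1 := N :* con 1 :+ con 1) refl N)
  ^≤oddFalling (suc k) zero          = z≤n
  ^≤oddFalling (suc k) (suc zero)    = begin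
    1 ^ suc (suc k)                            ≡⟨ ^-zeroˡ (suc (suc k)) ⟩
    1                                          ≤⟨ s≤s z≤n ⟩
    suc (suc k) * suc (suc k) * 1              ≡⟨ cong (suc (suc k) * suc (suc k) *_) (^-zeroˡ (suc k)) ⟨
    suc (suc k) * suc (suc k) * 1 ^ suc k      ≤⟨ m≤n+m _ (oddFalling 1 (suc (suc k))) ⟩
    oddFalling 1 (suc (suc k)) + suc (suc k) * suc (suc k) * 1 ^ suc k ∎
    where open ≤-Reasoning
  ^≤oddFalling (suc k) (suc (suc M)) = begin
    N * N ^ suc k
      ≡⟨ cong (λ x → N * x ^ suc k) N≡M+2 ⟩
    N * (M + 2) ^ suc k
      ≤⟨ *-monoʳ-≤ N (^-suc-+-≤ k M 2) ⟩
    N * (M ^ suc k + suc k * 2 * (M + 2) ^ k)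
      ≡⟨ cong (λ x → N * (M ^ suc k + suc k * 2 * x ^ k)) N≡M+2 ⟨
    N * (M ^ suc k + suc k * 2 * N ^ k)
      ≤⟨ *-monoʳ-≤ N (+-monoˡ-≤ _ (^≤oddFalling k M)) ⟩
    N * (P + suc k * suc k * M ^ k + suc k * 2 * N ^ k)
      ≤⟨ *-monoʳ-≤ N (+-monoˡ-≤ _ (+-monoʳ-≤ P (*-monoʳ-≤ (suc k * suc k) (^-monoˡ-≤ k (m≤n+m M 2))))) ⟩
    N * (P + suc k * suc k * N ^ k + suc k * 2 * N ^ k)
      ≡⟨ solve 4 (λ M p k x → (con 2 :+ M) :* (p :+ (con 1 :+ k) :* (con 1 :+ k) :* x :+ (con 1 :+ k) :* con 2 :* x)
                             := (con 1 :+ M) :* p :+ p :+ ((con 1 :+ k) :* (con 1 :+ k) :+ (con 1 :+ k) :* con 2) :* ((con 2 :+ M) :* x))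
                 refl M P k (N ^ k) ⟩
    suc M * P + P + (suc k * suc k + suc k * 2) * (N * N ^ k)
      ≤⟨ +-monoˡ-≤ _ (+-monoʳ-≤ (suc M * P) (≤-trans (oddFalling≤^ M (suc k)) (^-monoˡ-≤ (suc k) (m≤n+m M 2)))) ⟩
    suc M * P + N * N ^ k + (suc k * suc k + suc k * 2) * (N * N ^ k)
      ≡⟨ solve 3 (λ p y k → p :+ y :+ ((con 1 :+ k) :* (con 1 :+ k) :+ (con 1 :+ k) :* con 2) :* y
                           := p :+ (con 2 :+ k) :* (con 2 :+ k) :* y)
                 refl (suc M * P) (N * N ^ k) k ⟩
    suc M * P + suc (suc k) * suc (suc k) * (N * N ^ k) ∎
    where
    open ≤-Reasoning
    N = suc (suc M)
    P = oddFalling M (suc k)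
    N≡M+2 : N ≡ M + 2
    N≡M+2 = +-comm 2 M

  suc^≤oddFalling : ∀ k r → suc r ^ k ≤ oddFalling (double k + r) k
  suc^≤oddFalling zero    r = ≤-refl
  suc^≤oddFalling (suc k) r = *-mono-≤ (s≤s (m≤n+m r (double k))) (suc^≤oddFalling k r)

  ^≤double^*oddFalling : ∀ k N → double k ≤ N → N ^ k ≤ double k ^ k * oddFalling N k
  ^≤double^*oddFalling zero    N _    = ≤-refl
  ^≤double^*oddFalling (suc k) N 2k≤N with m≤n⇒∃[o]m+o≡n 2k≤N
  ... | r , refl = begin
    (2k + r) ^ suc k                   ≤⟨ ^-monoˡ-≤ (suc k) N≤2k*[r+1] ⟩
    (2k * suc r) ^ suc k               ≡⟨ ^-distribʳ-* 2k (suc r) (suc k) ⟩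
    2k ^ suc k * suc r ^ suc k         ≤⟨ *-monoʳ-≤ (2k ^ suc k) (suc^≤oddFalling (suc k) r) ⟩
    2k ^ suc k * oddFalling (2k + r) (suc k) ∎
    where
    open ≤-Reasoning
    2k = double (suc k)
    N≤2k*[r+1] : 2k + r ≤ 2k * suc r
    N≤2k*[r+1] = ≤-trans (+-monoʳ-≤ 2k (m≤n*m r 2k)) (≤-reflexive (sym (*-suc 2k r)))

module LoopTupleEstimate where

  open LoopTuples
  open LoopTupleBounds
  open import Data.Nat using (ℕ; zero; suc; _+_; _*_; _^_; _≤_; _<_; s≤s; z≤n; _≤?_)
  open import Data.Nat.Properties
  open import Data.Product using (_×_; _,_; proj₂)
  open import Relation.Nullary using (yes; no)
  open import Relation.Binary.PropositionalEquality
  open import Data.Nat.Solver using (module +-*-Solver)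
  open +-*-Solver

  Close : ℕ → ℕ → ℕ → Set
  Close x y e = x ≤ y + e × y ≤ x + e

  close-from-upper : ∀ {x y m e} → x ≤ m → y ≤ m → m ≤ x + e → m ≤ y + e → Close x y e
  close-from-upper x≤m y≤m m≤x+e m≤y+e = ≤-trans x≤m m≤y+e , ≤-trans y≤m m≤x+e

  Close-*ʳ : ∀ {x y e} z → Close x y e → Close (x * z) (y * z) (e * z)
  Close-*ʳ {x} {y} {e} z (x≤ , y≤) =
    ≤-trans (*-monoˡ-≤ z x≤) (≤-reflexive (*-distribʳ-+ z y e)) ,
    ≤-trans (*-monoˡ-≤ z y≤) (≤-reflexive (*-distribʳ-+ z x e))

  Close-resp : ∀ {x y e x′ y′ e′} → x ≡ x′ → y ≡ y′ → e ≡ e′ → Close x y e → Close x′ y′ e′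
  Close-resp refl refl refl close = close

  -- The three parts of errorConst K k pay for choose2 a ^ k - orderedPairings a k, for
  -- N ^ k - oddFalling N k, and for the range N < 2k where loopTuples vanishes.
  pairingError matchingError sparseError errorConst : ℕ → ℕ → ℕ
  pairingError K (suc (suc j)) = suc (suc j) * suc j * K ^ j * double (suc (suc j)) ^ suc (suc j)
  pairingError K _             = 0
  matchingError K zero    = 0
  matchingError K (suc j) = suc j * suc j * K ^ j * double (suc j) ^ suc j
  sparseError K zero    = 0
  sparseError K (suc j) = K ^ j * double (suc j)
  errorConst K k = pairingError K k + matchingError K k + sparseError K k

  ^-mono-≤-* : ∀ {t} K N m → t ≤ K * N → t ^ m ≤ K ^ m * N ^ m
  ^-mono-≤-* K N m t≤KN = ≤-trans (^-monoˡ-≤ m t≤KN) (≤-reflexive (^-distribʳ-* K N m))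

  ≤-insert-suc : ∀ t a F X → t * F * X ≤ t * suc a * F * X
  ≤-insert-suc t a F X = *-monoˡ-≤ X (*-monoˡ-≤ F (≤-trans (≤-reflexive (sym (*-identityʳ t))) (*-monoʳ-≤ t (s≤s z≤n))))

  pairing-defect : ∀ K a N j → double (suc j) ≤ N → choose2 a ≤ K * N →
    suc j * j * a * choose2 a ^ j * N ^ suc j * (N * N)
      ≤ pairingError K (suc j) * (choose2 a * suc a * oddFalling N (suc j) * N ^ suc j)
  pairing-defect K a N zero    _    _     = z≤n
  pairing-defect K a N (suc j) 2k≤N t≤KN = begin
    c * a * (t * t ^ j) * (N * (N * N ^ j)) * (N * N)
      ≤⟨ *-monoˡ-≤ (N * N) (*-monoˡ-≤ (N * (N * N ^ j)) (*-monoʳ-≤ (c * a) (*-monoʳ-≤ t (^-mono-≤-* K N j t≤KN)))) ⟩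
    c * a * (t * (K ^ j * N ^ j)) * (N * (N * N ^ j)) * (N * N)
      ≡⟨ solve 6 (λ c a t x y N → c :* a :* (t :* (x :* y)) :* (N :* (N :* y)) :* (N :* N)
                                  := c :* x :* (t :* a) :* (N :* (N :* y)) :* (N :* (N :* y)))
                 refl c a t (K ^ j) (N ^ j) N ⟩
    c * K ^ j * (t * a) * N ^ k * N ^ k
      ≤⟨ *-monoʳ-≤ (c * K ^ j * (t * a) * N ^ k) (^≤double^*oddFalling k N 2k≤N) ⟩
    c * K ^ j * (t * a) * N ^ k * (double k ^ k * P)
      ≤⟨ *-monoˡ-≤ (double k ^ k * P) (*-monoˡ-≤ (N ^ k) (*-monoʳ-≤ (c * K ^ j) (*-monoʳ-≤ t (n≤1+n a)))) ⟩
    c * K ^ j * (t * suc a) * N ^ k * (double k ^ k * P)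
      ≡⟨ solve 6 (λ c x s y w p → c :* x :* s :* y :* (w :* p) := c :* x :* w :* (s :* p :* y))
                 refl c (K ^ j) (t * suc a) (N ^ k) (double k ^ k) P ⟩
    pairingError K k * (t * suc a * P * N ^ k) ∎
    where
    open ≤-Reasoning
    k = suc (suc j)
    c = suc (suc j) * suc j
    t = choose2 a
    P = oddFalling N k

  matching-defect : ∀ K a N j → double (suc j) ≤ N → choose2 a ≤ K * N →
    choose2 a ^ suc j * (suc j * suc j * N ^ j) * (N * N)
      ≤ matchingError K (suc j) * (choose2 a * suc a * oddFalling N (suc j) * N ^ suc j)
  matching-defect K a N j 2k≤N t≤KN = begin
    (t * t ^ j) * (c * N ^ j) * (N * N)
      ≤⟨ *-monoˡ-≤ (N * N) (*-monoˡ-≤ (c * N ^ j) (*-monoʳ-≤ t (^-mono-≤-* K N j t≤KN))) ⟩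
    (t * (K ^ j * N ^ j)) * (c * N ^ j) * (N * N)
      ≡⟨ solve 5 (λ c t x y N → (t :* (x :* y)) :* (c :* y) :* (N :* N) := c :* x :* t :* (N :* y) :* (N :* y))
                 refl c t (K ^ j) (N ^ j) N ⟩
    c * K ^ j * t * N ^ k * N ^ k
      ≤⟨ *-monoʳ-≤ (c * K ^ j * t * N ^ k) (^≤double^*oddFalling k N 2k≤N) ⟩
    c * K ^ j * t * N ^ k * (double k ^ k * P)
      ≡⟨ solve 6 (λ c x t y w p → c :* x :* t :* y :* (w :* p) := c :* x :* w :* (t :* p :* y))
                 refl c (K ^ j) t (N ^ k) (double k ^ k) P ⟩
    matchingError K k * (t * P * N ^ k)
      ≤⟨ *-monoʳ-≤ (matchingError K k) (≤-insert-suc t a P (N ^ k)) ⟩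
    matchingError K k * (t * suc a * P * N ^ k) ∎
    where
    open ≤-Reasoning
    k = suc j
    c = suc j * suc j
    t = choose2 a
    P = oddFalling N k

  orderedPairings-close : ∀ K a N k → double k ≤ N → choose2 a ≤ K * N →
    Close (orderedPairings a k * N ^ k * (N * N)) (oddFalling N k * choose2 a ^ k * (N * N))
          (errorConst K k * (choose2 a * suc a * oddFalling N k * N ^ k))
  orderedPairings-close K a N zero    _    _     = m≤m+n _ 0 , m≤m+n _ 0
  orderedPairings-close K a N (suc j) 2k≤N t≤KN = close-from-upper
    (*-monoˡ-≤ NN (*-monoˡ-≤ (N ^ k) (orderedPairings≤choose2^ a k)))
    (≤-trans (≤-reflexive (cong (_* NN) (*-comm P (t ^ k)))) (*-monoˡ-≤ NN (*-monoʳ-≤ (t ^ k) (oddFalling≤^ N k))))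
    (begin
      t ^ k * N ^ k * NN                                          ≤⟨ *-monoˡ-≤ NN (*-monoˡ-≤ (N ^ k) (choose2^≤orderedPairings j a)) ⟩
      (Q + k * j * a * t ^ j) * N ^ k * NN                        ≡⟨ solve 4 (λ q u x n → (q :+ u) :* x :* n := q :* x :* n :+ u :* x :* n)
                                                                            refl Q (k * j * a * t ^ j) (N ^ k) NN ⟩
      Q * N ^ k * NN + k * j * a * t ^ j * N ^ k * NN             ≤⟨ +-monoʳ-≤ (Q * N ^ k * NN) (pairing-defect K a N j 2k≤N t≤KN) ⟩
      Q * N ^ k * NN + pairingError K k * E                       ≤⟨ +-monoʳ-≤ (Q * N ^ k * NN) (*-monoˡ-≤ E pairing≤) ⟩
      Q * N ^ k * NN + errorConst K k * E                         ∎)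
    (begin
      t ^ k * N ^ k * NN                                          ≤⟨ *-monoˡ-≤ NN (*-monoʳ-≤ (t ^ k) (^≤oddFalling j N)) ⟩
      t ^ k * (P + k * k * N ^ j) * NN                            ≡⟨ solve 4 (λ x p u n → x :* (p :+ u) :* n := p :* x :* n :+ x :* u :* n)
                                                                            refl (t ^ k) P (k * k * N ^ j) NN ⟩
      P * t ^ k * NN + t ^ k * (k * k * N ^ j) * NN               ≤⟨ +-monoʳ-≤ (P * t ^ k * NN) (matching-defect K a N j 2k≤N t≤KN) ⟩
      P * t ^ k * NN + matchingError K k * E                      ≤⟨ +-monoʳ-≤ (P * t ^ k * NN) (*-monoˡ-≤ E matching≤) ⟩
      P * t ^ k * NN + errorConst K k * E                         ∎)
    where
    open ≤-Reasoning
    k  = suc j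
    t  = choose2 a
    Q  = orderedPairings a k
    P  = oddFalling N k
    NN = N * N
    E  = t * suc a * P * N ^ k
    pairing≤ : pairingError K k ≤ errorConst K k
    pairing≤ = ≤-trans (m≤m+n _ (matchingError K k)) (m≤m+n _ (sparseError K k))
    matching≤ : matchingError K k ≤ errorConst K k
    matching≤ = ≤-trans (m≤n+m _ (pairingError K k)) (m≤m+n _ (sparseError K k))

  -- Divided by matchingCount N · N ^ (k + 2), with N = a + b, this reads
  -- |E (X)ₖ - λᵏ| ≤ errorConst K k · λ (a + 1) / N for λ = choose2 a / N.
  LoopTuplesClose : ℕ → ℕ → ℕ → ℕ → Set
  LoopTuplesClose K a b k =
    Close (loopTuples a b k * (a + b) ^ k * ((a + b) * (a + b)))
          (matchingCount (a + b) * choose2 a ^ k * ((a + b) * (a + b)))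
          (errorConst K k * (choose2 a * suc a * matchingCount (a + b) * (a + b) ^ k))

  loopTuples-close-dense : ∀ K a b k r → double k + r ≡ a + b → choose2 a ≤ K * (a + b) → LoopTuplesClose K a b k
  loopTuples-close-dense K a b k r 2k+r≡N t≤KN = Close-resp
    (trans (rearrange (orderedPairings a k) (N ^ k) NN (matchingCount r)) (cong (λ x → x * N ^ k * NN) (sym G≡)))
    (trans (rearrange (oddFalling N k) (t ^ k) NN (matchingCount r)) (cong (λ x → x * t ^ k * NN) (sym D≡)))
    (trans (solve 6 (λ c t s p x m → c :* (t :* s :* p :* x) :* m := c :* (t :* s :* (p :* m) :* x)) refl
                    (errorConst K k) t (suc a) (oddFalling N k) (N ^ k) (matchingCount r))
           (cong (λ x → errorConst K k * (t * suc a * x * N ^ k)) (sym D≡)))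
    (Close-*ʳ (matchingCount r) (orderedPairings-close K a N k (≤-trans (m≤m+n (double k) r) (≤-reflexive 2k+r≡N)) t≤KN))
    where
    N  = a + b
    NN = N * N
    t  = choose2 a
    G≡ : loopTuples a b k ≡ orderedPairings a k * matchingCount r
    G≡ = loopTuples-factor k a b r (sym 2k+r≡N)
    D≡ : matchingCount N ≡ oddFalling N k * matchingCount r
    D≡ = subst (λ M → matchingCount M ≡ oddFalling M k * matchingCount r) 2k+r≡N (matchingCount-factor k r)
    rearrange : ∀ q x y m → q * x * y * m ≡ q * m * x * y
    rearrange = solve 4 (λ q x y m → q :* x :* y :* m := q :* m :* x :* y) refl

  loopTuples-close-sparse : ∀ K a b k → a + b < double k → choose2 a ≤ K * (a + b) → LoopTuplesClose K a b k
  loopTuples-close-sparse K a b (suc j) N<2k t≤KN =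
    subst (λ G → Close (G * N ^ k * NN) y e) (sym (loopTuples-vanish k a b N<2k)) (z≤n , y≤e)
    where
    open ≤-Reasoning
    k  = suc j
    N  = a + b
    NN = N * N
    t  = choose2 a
    F  = matchingCount N
    y  = F * t ^ k * NN
    e  = errorConst K k * (t * suc a * F * N ^ k)
    y≤e : y ≤ 0 * N ^ k * NN + e
    y≤e = begin
      F * (t * t ^ j) * NN                        ≤⟨ *-monoˡ-≤ NN (*-monoʳ-≤ F (*-monoʳ-≤ t (^-mono-≤-* K N j t≤KN))) ⟩
      F * (t * (K ^ j * N ^ j)) * (N * N)         ≤⟨ *-monoʳ-≤ (F * (t * (K ^ j * N ^ j))) (*-monoʳ-≤ N (<⇒≤ N<2k)) ⟩
      F * (t * (K ^ j * N ^ j)) * (N * double k)  ≡⟨ solve 6 (λ f t x y N d → f :* (t :* (x :* y)) :* (N :* d) := x :* d :* (t :* f :* (N :* y)))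
                                                              refl F t (K ^ j) (N ^ j) N (double k) ⟩
      sparseError K k * (t * F * N ^ k)           ≤⟨ *-mono-≤ (m≤n+m _ (pairingError K k + matchingError K k)) (≤-insert-suc t a F (N ^ k)) ⟩
      e                                           ∎

  loopTuples-close : ∀ K a b k → a * a ≤ K * (a + b) → LoopTuplesClose K a b k
  loopTuples-close K a b k a²≤KN with double k ≤? a + b
  ... | yes 2k≤N = loopTuples-close-dense K a b k _ (proj₂ (m≤n⇒∃[o]m+o≡n 2k≤N)) (≤-trans (choose2≤square a) a²≤KN)
  ... | no 2k≰N  = loopTuples-close-sparse K a b k (≰⇒> 2k≰N) (≤-trans (choose2≤square a) a²≤KN)

  n≤n*n : ∀ n → n ≤ n * n
  n≤n*n zero    = z≤n
  n≤n*n (suc n) = m≤m*n (suc n) (suc n)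

  suc²≤suc²* : ∀ K a N → 1 ≤ N → a * a ≤ K * N → suc a * suc a ≤ suc K * suc K * N
  suc²≤suc²* K a N 1≤N a²≤KN = begin
    suc a * suc a                     ≡⟨ solve 1 (λ a → (con 1 :+ a) :* (con 1 :+ a) := con 1 :+ (a :+ a) :+ a :* a) refl a ⟩
    1 + (a + a) + a * a               ≤⟨ +-mono-≤ (+-mono-≤ 1≤N (+-mono-≤ a≤KN a≤KN)) (≤-trans a²≤KN (*-monoˡ-≤ N (n≤n*n K))) ⟩
    N + (K * N + K * N) + K * K * N   ≡⟨ solve 2 (λ K N → N :+ (K :* N :+ K :* N) :+ K :* K :* N := (con 1 :+ K) :* (con 1 :+ K) :* N) refl K N ⟩
    suc K * suc K * N                 ∎
    where
    open ≤-Reasoning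
    a≤KN = ≤-trans (n≤n*n a) a²≤KN

module RationalEmbedding where

  open import Defs using (powℚ)
  open import Data.Nat as ℕ using (ℕ; zero; suc)
  import Data.Nat.Properties as ℕ
  open import Data.Integer as ℤ using (+_; -[1+_])
  import Data.Integer.Properties as ℤ
  open import Data.Rational using (ℚ; mkℚ; _/_; _+_; _*_; _≤_; 0ℚ; 1ℚ; toℚᵘ)
  open import Data.Product using (Σ; _,_)
  open import Data.Rational.Properties
  open import Data.Rational.Unnormalised as ℚᵘ using (mkℚᵘ; *≡*; *≤*) renaming (_≃_ to _≃ᵘ_)
  import Data.Rational.Unnormalised.Properties as ℚᵘ
  open import Relation.Binary.PropositionalEquality
  open import Data.Rational.Solver using (module +-*-Solver)
  open +-*-Solver

  fromℕ : ℕ → ℚ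
  fromℕ n = (+ n) / 1

  toℚᵘ-fromℕ : ∀ m → toℚᵘ (fromℕ m) ≃ᵘ mkℚᵘ (+ m) 0
  toℚᵘ-fromℕ m = toℚᵘ-fromℚᵘ (mkℚᵘ (+ m) 0)

  fromℕ-+ : ∀ m n → fromℕ (m ℕ.+ n) ≡ fromℕ m + fromℕ n
  fromℕ-+ m n = toℚᵘ-injective (ℚᵘ.≃-trans (toℚᵘ-fromℕ (m ℕ.+ n)) (ℚᵘ.≃-sym
    (ℚᵘ.≃-trans (toℚᵘ-homo-+ (fromℕ m) (fromℕ n)) (ℚᵘ.≃-trans (ℚᵘ.+-cong (toℚᵘ-fromℕ m) (toℚᵘ-fromℕ n)) (*≡* eq)))))
    where
    eq : (+ m ℤ.* + 1 ℤ.+ + n ℤ.* + 1) ℤ.* + 1 ≡ + (m ℕ.+ n) ℤ.* + 1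
    eq = cong (ℤ._* + 1) (trans (cong₂ ℤ._+_ (ℤ.*-identityʳ (+ m)) (ℤ.*-identityʳ (+ n))) (sym (ℤ.pos-+ m n)))

  fromℕ-* : ∀ m n → fromℕ (m ℕ.* n) ≡ fromℕ m * fromℕ n
  fromℕ-* m n = toℚᵘ-injective (ℚᵘ.≃-trans (toℚᵘ-fromℕ (m ℕ.* n)) (ℚᵘ.≃-sym
    (ℚᵘ.≃-trans (toℚᵘ-homo-* (fromℕ m) (fromℕ n)) (ℚᵘ.≃-trans (ℚᵘ.*-cong (toℚᵘ-fromℕ m) (toℚᵘ-fromℕ n)) (*≡* eq)))))
    where
    eq : (+ m ℤ.* + n) ℤ.* + 1 ≡ + (m ℕ.* n) ℤ.* + 1
    eq = cong (ℤ._* + 1) (sym (ℤ.pos-* m n))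

  fromℕ-^ : ∀ m k → fromℕ (m ℕ.^ k) ≡ powℚ (fromℕ m) k
  fromℕ-^ m zero    = refl
  fromℕ-^ m (suc k) = trans (fromℕ-* m (m ℕ.^ k)) (cong (fromℕ m *_) (fromℕ-^ m k))

  fromℕ-mono-≤ : ∀ {m n} → m ℕ.≤ n → fromℕ m ≤ fromℕ n
  fromℕ-mono-≤ {m} {n} m≤n =
    toℚᵘ-cancel-≤ (ℚᵘ.≤-respˡ-≃ (ℚᵘ.≃-sym (toℚᵘ-fromℕ m)) (ℚᵘ.≤-respʳ-≃ (ℚᵘ.≃-sym (toℚᵘ-fromℕ n)) (*≤* le)))
    where
    le : + m ℤ.* + 1 ℤ.≤ + n ℤ.* + 1
    le = subst₂ ℤ._≤_ (sym (ℤ.*-identityʳ (+ m))) (sym (ℤ.*-identityʳ (+ n))) (ℤ.+≤+ m≤n)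

  fromℕ-cancel-≤ : ∀ {m n} → fromℕ m ≤ fromℕ n → m ℕ.≤ n
  fromℕ-cancel-≤ {m} {n} le with ℚᵘ.≤-respˡ-≃ (toℚᵘ-fromℕ m) (ℚᵘ.≤-respʳ-≃ (toℚᵘ-fromℕ n) (toℚᵘ-mono-≤ le))
  ... | *≤* le′ = ℤ.drop‿+≤+ (subst₂ ℤ._≤_ (ℤ.*-identityʳ (+ m)) (ℤ.*-identityʳ (+ n)) le′)

  0≤fromℕ : ∀ m → 0ℚ ≤ fromℕ m
  0≤fromℕ m = fromℕ-mono-≤ {0} {m} ℕ.z≤n

  -- The reciprocal 1/(m + 1), indexed by the predecessor so that no proof of non-zeroness is needed.
  1/suc : ℕ → ℚ
  1/suc m = (+ 1) / suc m

  0≤1/suc : ∀ m → 0ℚ ≤ 1/suc m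
  0≤1/suc m = nonNegative⁻¹ (1/suc m) {{normalize-nonNeg 1 (suc m)}}

  /suc≡fromℕ*fromℕ-suc : ∀ x m → ((+ x) / suc m) * fromℕ (suc m) ≡ fromℕ x
  /suc≡fromℕ*fromℕ-suc x m = toℚᵘ-injective (ℚᵘ.≃-trans (toℚᵘ-homo-* ((+ x) / suc m) (fromℕ (suc m)))
    (ℚᵘ.≃-trans (ℚᵘ.*-cong (toℚᵘ-fromℚᵘ (mkℚᵘ (+ x) m)) (toℚᵘ-fromℕ (suc m)))
                (ℚᵘ.≃-trans (*≡* eq) (ℚᵘ.≃-sym (toℚᵘ-fromℕ x)))))
    where
    eq : (+ x ℤ.* + suc m) ℤ.* + 1 ≡ + x ℤ.* + (suc m ℕ.* 1)
    eq = trans (ℤ.*-identityʳ (+ x ℤ.* + suc m)) (cong (λ z → + x ℤ.* + z) (sym (ℕ.*-identityʳ (suc m))))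

  fromℕ-suc*1/suc : ∀ m → fromℕ (suc m) * 1/suc m ≡ 1ℚ
  fromℕ-suc*1/suc m = trans (*-comm (fromℕ (suc m)) (1/suc m)) (/suc≡fromℕ*fromℕ-suc 1 m)

  *-cancelʳ-fromℕ-suc : ∀ p q m → p * fromℕ (suc m) ≡ q * fromℕ (suc m) → p ≡ q
  *-cancelʳ-fromℕ-suc p q m eq = begin
    p                             ≡⟨ *-identityʳ p ⟨
    p * 1ℚ                        ≡⟨ cong (p *_) (fromℕ-suc*1/suc m) ⟨
    p * (fromℕ (suc m) * 1/suc m) ≡⟨ *-assoc p _ _ ⟨
    p * fromℕ (suc m) * 1/suc m   ≡⟨ cong (_* 1/suc m) eq ⟩
    q * fromℕ (suc m) * 1/suc m   ≡⟨ *-assoc q _ _ ⟩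
    q * (fromℕ (suc m) * 1/suc m) ≡⟨ cong (q *_) (fromℕ-suc*1/suc m) ⟩
    q * 1ℚ                        ≡⟨ *-identityʳ q ⟩
    q                             ∎
    where open ≡-Reasoning

  /suc≡fromℕ*1/suc : ∀ x m → (+ x) / suc m ≡ fromℕ x * 1/suc m
  /suc≡fromℕ*1/suc x m = *-cancelʳ-fromℕ-suc _ _ m (begin
    ((+ x) / suc m) * fromℕ (suc m)     ≡⟨ /suc≡fromℕ*fromℕ-suc x m ⟩
    fromℕ x                             ≡⟨ *-identityʳ (fromℕ x) ⟨
    fromℕ x * 1ℚ                        ≡⟨ cong (fromℕ x *_) (trans (*-comm (1/suc m) (fromℕ (suc m))) (fromℕ-suc*1/suc m)) ⟨
    fromℕ x * (1/suc m * fromℕ (suc m)) ≡⟨ *-assoc (fromℕ x) _ _ ⟨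
    fromℕ x * 1/suc m * fromℕ (suc m)   ∎)
    where open ≡-Reasoning

  2*/2*suc≡fromℕ*1/suc : ∀ x m → (+ (2 ℕ.* x)) / (2 ℕ.* suc m) ≡ fromℕ x * 1/suc m
  2*/2*suc≡fromℕ*1/suc x m = *-cancelʳ-fromℕ-suc _ _ (ℕ.pred (2 ℕ.* suc m)) (begin
    ((+ (2 ℕ.* x)) / (2 ℕ.* suc m)) * fromℕ (2 ℕ.* suc m)     ≡⟨ /suc≡fromℕ*fromℕ-suc (2 ℕ.* x) (ℕ.pred (2 ℕ.* suc m)) ⟩
    fromℕ (2 ℕ.* x)                                           ≡⟨ fromℕ-* 2 x ⟩
    fromℕ 2 * fromℕ x                                         ≡⟨ *-identityʳ _ ⟨
    fromℕ 2 * fromℕ x * 1ℚ                                    ≡⟨ cong (fromℕ 2 * fromℕ x *_) (fromℕ-suc*1/suc m) ⟨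
    fromℕ 2 * fromℕ x * (fromℕ (suc m) * 1/suc m)             ≡⟨ solve 4 (λ c x s u → c :* x :* (s :* u) := x :* u :* (c :* s)) refl
                                                                          (fromℕ 2) (fromℕ x) (fromℕ (suc m)) (1/suc m) ⟩
    fromℕ x * 1/suc m * (fromℕ 2 * fromℕ (suc m))             ≡⟨ cong (fromℕ x * 1/suc m *_) (fromℕ-* 2 (suc m)) ⟨
    fromℕ x * 1/suc m * fromℕ (2 ℕ.* suc m)                   ∎)
    where open ≡-Reasoning

  natAbove : ∀ p → Σ ℕ (λ K → p ≤ fromℕ K)
  natAbove (mkℚ (+ m) d _) = m , toℚᵘ-cancel-≤ (ℚᵘ.≤-respʳ-≃ (ℚᵘ.≃-sym (toℚᵘ-fromℕ m)) (*≤* le))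
    where
    le : + m ℤ.* + 1 ℤ.≤ + m ℤ.* + suc d
    le = subst₂ ℤ._≤_ (ℤ.pos-* m 1) (ℤ.pos-* m (suc d)) (ℤ.+≤+ (ℕ.*-monoʳ-≤ m (ℕ.s≤s ℕ.z≤n)))
  natAbove (mkℚ -[1+ m ] d _) = 0 , toℚᵘ-cancel-≤ (ℚᵘ.≤-respʳ-≃ (ℚᵘ.≃-sym (toℚᵘ-fromℕ 0)) (*≤* le))
    where
    le : -[1+ m ] ℤ.* + 1 ℤ.≤ + 0 ℤ.* + suc d
    le = subst₂ ℤ._≤_ (sym (ℤ.*-identityʳ -[1+ m ])) (sym (ℤ.*-zeroˡ (+ suc d))) ℤ.-≤+

module RationalBasics where

  open import Defs using (powℚ)
  open RationalEmbedding
  open import Data.Nat as ℕ using (ℕ; zero; suc)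
  open import Data.Rational using (ℚ; _+_; _*_; _-_; -_; _≤_; 0ℚ; 1ℚ; ∣_∣; nonNegative)
  open import Data.Rational.Properties
  open import Data.Sum using (inj₁; inj₂)
  open import Relation.Binary.PropositionalEquality
  open import Data.Rational.Solver using (module +-*-Solver)
  open +-*-Solver

  powℚ-distrib-* : ∀ p q k → powℚ (p * q) k ≡ powℚ p k * powℚ q k
  powℚ-distrib-* p q zero    = refl
  powℚ-distrib-* p q (suc k) = trans (cong (p * q *_) (powℚ-distrib-* p q k))
    (solve 4 (λ p q x y → p :* q :* (x :* y) := p :* x :* (q :* y)) refl p q (powℚ p k) (powℚ q k))

  powℚ-1 : ∀ k → powℚ 1ℚ k ≡ 1ℚ
  powℚ-1 zero    = refl
  powℚ-1 (suc k) = trans (*-identityˡ (powℚ 1ℚ k)) (powℚ-1 k)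

  0≤* : ∀ {p q} → 0ℚ ≤ p → 0ℚ ≤ q → 0ℚ ≤ p * q
  0≤* {p} {q} 0≤p 0≤q = nonNegative⁻¹ (p * q) {{nonNeg*nonNeg⇒nonNeg p {{nonNegative 0≤p}} q {{nonNegative 0≤q}}}}

  0≤powℚ : ∀ p k → 0ℚ ≤ p → 0ℚ ≤ powℚ p k
  0≤powℚ p zero    0≤p = 0≤fromℕ 1
  0≤powℚ p (suc k) 0≤p = 0≤* 0≤p (0≤powℚ p k 0≤p)

  *-monoʳ-≤-0≤ : ∀ {p q} r → 0ℚ ≤ r → p ≤ q → p * r ≤ q * r
  *-monoʳ-≤-0≤ r 0≤r = *-monoʳ-≤-nonNeg r {{nonNegative 0≤r}}

  ∣p-q∣≤r : ∀ {p q r} → p ≤ q + r → q ≤ p + r → ∣ p - q ∣ ≤ r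
  ∣p-q∣≤r {p} {q} {r} p≤q+r q≤p+r with ∣p∣≡p∨∣p∣≡-p (p - q)
  ... | inj₁ eq = ≤-trans (≤-reflexive eq)
                    (≤-trans (+-monoˡ-≤ (- q) p≤q+r) (≤-reflexive (solve 2 (λ q r → q :+ r :- q := r) refl q r)))
  ... | inj₂ eq = ≤-trans (≤-reflexive eq)
                    (≤-trans (≤-reflexive (solve 2 (λ p q → :- (p :- q) := q :- p) refl p q))
                      (≤-trans (+-monoˡ-≤ (- p) q≤p+r) (≤-reflexive (solve 2 (λ p r → p :+ r :- p := r) refl p r))))

module RationalSums where

  open import Defs using (powℚ; stirling2; poissonMoment)
  open StirlingExpansion using (sumUpTo)
  open RationalEmbedding
  open import Data.Nat as ℕ using (ℕ; zero; suc)
  open import Data.Rational using (ℚ; _+_; _*_; _≤_; 0ℚ; nonNegative)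
  open import Data.Rational.Properties
  open import Relation.Binary.PropositionalEquality
  open import Data.Rational.Solver using (module +-*-Solver)
  open +-*-Solver

  sumUpToℚ : (ℕ → ℚ) → ℕ → ℚ
  sumUpToℚ f zero    = f zero
  sumUpToℚ f (suc m) = f (suc m) + sumUpToℚ f m

  sumUpToℚ-cong : ∀ {f g} m → (∀ k → f k ≡ g k) → sumUpToℚ f m ≡ sumUpToℚ g m
  sumUpToℚ-cong zero    f≗g = f≗g zero
  sumUpToℚ-cong (suc m) f≗g = cong₂ _+_ (f≗g (suc m)) (sumUpToℚ-cong m f≗g)

  sumUpToℚ-*ʳ : ∀ f r m → sumUpToℚ f m * r ≡ sumUpToℚ (λ k → f k * r) m
  sumUpToℚ-*ʳ f r zero    = refl
  sumUpToℚ-*ʳ f r (suc m) = trans (*-distribʳ-+ r (f (suc m)) (sumUpToℚ f m)) (cong (f (suc m) * r +_) (sumUpToℚ-*ʳ f r m))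

  sumUpToℚ-weighted-≤ : ∀ (c x y e : ℕ → ℚ) m → (∀ k → 0ℚ ≤ c k) → (∀ k → x k ≤ y k + e k) →
    sumUpToℚ (λ k → c k * x k) m ≤ sumUpToℚ (λ k → c k * y k) m + sumUpToℚ (λ k → c k * e k) m
  sumUpToℚ-weighted-≤ c x y e m 0≤c x≤y+e = go m
    where
    term : ∀ k → c k * x k ≤ c k * y k + c k * e k
    term k = ≤-trans (*-monoˡ-≤-nonNeg (c k) {{nonNegative (0≤c k)}} (x≤y+e k)) (≤-reflexive (*-distribˡ-+ (c k) (y k) (e k)))
    go : ∀ m → sumUpToℚ (λ k → c k * x k) m ≤ sumUpToℚ (λ k → c k * y k) m + sumUpToℚ (λ k → c k * e k) m
    go zero    = term zero
    go (suc m) = ≤-trans (+-mono-≤ (term (suc m)) (go m))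
      (≤-reflexive (solve 4 (λ a b p q → a :+ b :+ (p :+ q) := a :+ p :+ (b :+ q)) refl
                            (c (suc m) * y (suc m)) (c (suc m) * e (suc m)) (sumUpToℚ (λ k → c k * y k) m) (sumUpToℚ (λ k → c k * e k) m)))

  fromℕ-sumUpTo : ∀ f m → fromℕ (sumUpTo f m) ≡ sumUpToℚ (λ k → fromℕ (f k)) m
  fromℕ-sumUpTo f zero    = refl
  fromℕ-sumUpTo f (suc m) = trans (fromℕ-+ (f (suc m)) (sumUpTo f m)) (cong (fromℕ (f (suc m)) +_) (fromℕ-sumUpTo f m))

  fromℕ-sumUpTo-* : ∀ (c f : ℕ → ℕ) u m →
    fromℕ (sumUpTo (λ k → c k ℕ.* f k) m) * u ≡ sumUpToℚ (λ k → fromℕ (c k) * (fromℕ (f k) * u)) m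
  fromℕ-sumUpTo-* c f u m = begin
    fromℕ (sumUpTo (λ k → c k ℕ.* f k) m) * u                 ≡⟨ cong (_* u) (fromℕ-sumUpTo _ m) ⟩
    sumUpToℚ (λ k → fromℕ (c k ℕ.* f k)) m * u               ≡⟨ sumUpToℚ-*ʳ _ u m ⟩
    sumUpToℚ (λ k → fromℕ (c k ℕ.* f k) * u) m               ≡⟨ sumUpToℚ-cong m (λ k → trans (cong (_* u) (fromℕ-* (c k) (f k)))
                                                                                             (*-assoc (fromℕ (c k)) _ u)) ⟩
    sumUpToℚ (λ k → fromℕ (c k) * (fromℕ (f k) * u)) m       ∎
    where open ≡-Reasoning

  -- poissonMoment is computed by a helper local to its definition, which cannot be named
  -- here; the two metavariables below are solved by unification to that helper, the
  -- with-abstraction making its two ℕ-arguments independent.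
  private
    mutual
      poissonTail : ℚ → ℕ → ℚ
      poissonTail = _

      poissonMoment-suc : ∀ x l →
        poissonMoment x (suc l) ≡ fromℕ (stirling2 (suc l) (suc l)) * powℚ x (suc l) + poissonTail x l
      poissonMoment-suc x l = refl

    mutual
      poissonPartial : ℚ → ℕ → ℕ → ℚ
      poissonPartial = _

      poissonTail≡poissonPartial : ∀ x l → poissonTail x l ≡ poissonPartial x (suc l) l
      poissonTail≡poissonPartial x l with suc l
      ... | ℓ = refl

  poissonMoment≡sumUpToℚ : ∀ x ℓ → poissonMoment x ℓ ≡ sumUpToℚ (λ k → fromℕ (stirling2 ℓ k) * powℚ x k) ℓ
  poissonMoment≡sumUpToℚ x ℓ = partial ℓ
    where
    partial : ∀ m → poissonPartial x ℓ m ≡ sumUpToℚ (λ k → fromℕ (stirling2 ℓ k) * powℚ x k) m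
    partial zero    = refl
    partial (suc m) = cong (fromℕ (stirling2 ℓ (suc m)) * powℚ x (suc m) +_) (partial m)

module HalfEdges where

  open import Defs
  open MatchingCounts
  open import Data.Nat using (ℕ; zero; suc; _+_; _*_)
  open import Data.Nat.Properties using (+-assoc; +-suc; +-identityʳ; *-zeroʳ; *-suc)
  open import Data.Nat.ListAction using (sum)
  open import Data.List using ([]; _∷_; _++_; length; map; replicate; concatMap; tabulate; allFin)
  open import Data.List.Properties using (length-++; length-replicate; map-tabulate)
  open import Data.Fin using (Fin; zero; suc)
  open import Data.Bool using (true; false)
  open import Relation.Binary.PropositionalEquality
  open import Function using (_∘_)

  sum-tabulate-0 : ∀ n → sum (tabulate {n = n} (λ _ → 0)) ≡ 0
  sum-tabulate-0 zero    = refl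
  sum-tabulate-0 (suc n) = sum-tabulate-0 n

  sum-tabulate-δ : ∀ n (i : Fin n) (f : Fin n → ℕ) → sum (tabulate (λ j → χ (atSite i j) * f j)) ≡ f i
  sum-tabulate-δ (suc n) zero    f = trans (cong₂ _+_ (+-identityʳ (f zero)) (sum-tabulate-0 n)) (+-identityʳ (f zero))
  sum-tabulate-δ (suc n) (suc i) f = sum-tabulate-δ n i (f ∘ suc)

  module _ {n : ℕ} (i : Fin n) where

    #at-++ : ∀ xs ys → #at i (xs ++ ys) ≡ #at i xs + #at i ys
    #at-++ []       ys = refl
    #at-++ (x ∷ xs) ys = trans (cong (χ (atSite i x) +_) (#at-++ xs ys)) (sym (+-assoc (χ (atSite i x)) _ _))

    #at-replicate : ∀ m j → #at i (replicate m j) ≡ χ (atSite i j) * m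
    #at-replicate zero    j = sym (*-zeroʳ (χ (atSite i j)))
    #at-replicate (suc m) j = trans (cong (χ (atSite i j) +_) (#at-replicate m j)) (sym (*-suc (χ (atSite i j)) m))

    #at+#off≡length : ∀ xs → #at i xs + #off i xs ≡ length xs
    #at+#off≡length []       = refl
    #at+#off≡length (x ∷ xs) with atSite i x
    ... | true  = cong suc (#at+#off≡length xs)
    ... | false = trans (+-suc (#at i xs) (#off i xs)) (cong suc (#at+#off≡length xs))

    #at-halfEdges : (d : Fin n → ℕ) → #at i (halfEdges d) ≡ d i
    #at-halfEdges d = trans (#at-concat (allFin n))
      (trans (cong sum (map-tabulate (λ j → j) (λ j → χ (atSite i j) * d j))) (sum-tabulate-δ n i d))
      where
      #at-concat : ∀ xs → #at i (concatMap (λ j → replicate (d j) j) xs) ≡ sum (map (λ j → χ (atSite i j) * d j) xs)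
      #at-concat []       = refl
      #at-concat (x ∷ xs) = trans (#at-++ (replicate (d x) x) _) (cong₂ _+_ (#at-replicate (d x) x) (#at-concat xs))

  length-halfEdges : ∀ {n} (d : Fin n → ℕ) → length (halfEdges d) ≡ totalDeg d
  length-halfEdges {n} d = length-concat (allFin n)
    where
    length-concat : ∀ xs → length (concatMap (λ j → replicate (d j) j) xs) ≡ sum (map d xs)
    length-concat []       = refl
    length-concat (x ∷ xs) = trans (length-++ (replicate (d x) x)) (cong₂ _+_ (length-replicate (d x)) (length-concat xs))

module MomentBound where

  open import Defs using (powℚ; stirling2)
  open LoopTuples
  open StirlingExpansion using (sumUpTo)
  open LoopTupleEstimate
  open RationalEmbedding
  open RationalBasics
  open RationalSums
  open import Data.Nat as ℕ using (ℕ; suc)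
  import Data.Nat.Properties as ℕ
  open import Data.Rational using (ℚ; _+_; _*_; _-_; _≤_; 0ℚ; 1ℚ; ∣_∣; nonNegative)
  open import Data.Rational.Properties
  open import Data.Product using (_,_; swap)
  open import Relation.Binary.PropositionalEquality
  open import Data.Rational.Solver using (module +-*-Solver)
  open +-*-Solver

  fromℕ-close : ∀ {x y e} r → 0ℚ ≤ r → Close x y e → fromℕ x * r ≤ fromℕ y * r + fromℕ e * r
  fromℕ-close {x} {y} {e} r 0≤r (x≤y+e , _) =
    ≤-trans (*-monoʳ-≤-0≤ r 0≤r (fromℕ-mono-≤ x≤y+e))
            (≤-reflexive (trans (cong (_* r) (fromℕ-+ y e)) (*-distribʳ-+ r (fromℕ y) (fromℕ e))))

  loopMomentConst : ℕ → ℕ → ℕ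
  loopMomentConst K ℓ = sumUpTo (λ k → stirling2 ℓ k ℕ.* errorConst K k) ℓ

  module Vertex (K ℓ a b : ℕ) {N-1 D-1 : ℕ} (N≡ : a ℕ.+ b ≡ suc N-1) (D≡ : matchingCount (a ℕ.+ b) ≡ suc D-1)
           (a²≤KN : a ℕ.* a ℕ.≤ K ℕ.* (a ℕ.+ b)) where

    private
      N   = a ℕ.+ b
      n   = fromℕ N
      1/N = 1/suc N-1
      1/D = 1/suc D-1
      t   = choose2 a

      n*1/N≡1 : n * 1/N ≡ 1ℚ
      n*1/N≡1 = trans (cong (λ m → fromℕ m * 1/N) N≡) (fromℕ-suc*1/suc N-1)

      D*1/D≡1 : fromℕ (matchingCount N) * 1/D ≡ 1ℚ
      D*1/D≡1 = trans (cong (λ m → fromℕ m * 1/D) D≡) (fromℕ-suc*1/suc D-1)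

      n^k*1/N^k≡1 : ∀ k → powℚ n k * powℚ 1/N k ≡ 1ℚ
      n^k*1/N^k≡1 k = trans (sym (powℚ-distrib-* n 1/N k)) (trans (cong (λ p → powℚ p k) n*1/N≡1) (powℚ-1 k))

    λ̂ : ℚ
    λ̂ = fromℕ t * 1/N

    factorialMoment : ℕ → ℚ
    factorialMoment k = fromℕ (loopTuples a b k) * 1/D

    moment poisson : ℚ
    moment  = fromℕ (sumUpTo (λ k → stirling2 ℓ k ℕ.* loopTuples a b k) ℓ) * 1/D
    poisson = sumUpToℚ (λ k → fromℕ (stirling2 ℓ k) * powℚ λ̂ k) ℓ

    private
      unitError : ℚ
      unitError = λ̂ * fromℕ (suc a) * 1/N

      error : ℕ → ℚ
      error k = fromℕ (errorConst K k) * unitError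

      scale : ℕ → ℚ
      scale k = 1/D * powℚ 1/N k * (1/N * 1/N)

      0≤scale : ∀ k → 0ℚ ≤ scale k
      0≤scale k = 0≤* (0≤* (0≤1/suc D-1) (0≤powℚ 1/N k (0≤1/suc N-1))) (0≤* (0≤1/suc N-1) (0≤1/suc N-1))

      scale-moment : ∀ k → fromℕ (loopTuples a b k ℕ.* N ℕ.^ k ℕ.* (N ℕ.* N)) * scale k ≡ factorialMoment k
      scale-moment k = begin
        fromℕ (G ℕ.* N ℕ.^ k ℕ.* (N ℕ.* N)) * scale k
          ≡⟨ cong (_* scale k) (trans (fromℕ-* (G ℕ.* N ℕ.^ k) (N ℕ.* N))
                                 (cong₂ _*_ (trans (fromℕ-* G (N ℕ.^ k)) (cong (fromℕ G *_) (fromℕ-^ N k))) (fromℕ-* N N))) ⟩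
        fromℕ G * powℚ n k * (n * n) * (1/D * powℚ 1/N k * (1/N * 1/N))
          ≡⟨ solve 6 (λ g p n u q w → g :* p :* (n :* n) :* (u :* q :* (w :* w)) := g :* u :* (p :* q) :* (n :* w) :* (n :* w))
                     refl (fromℕ G) (powℚ n k) n 1/D (powℚ 1/N k) 1/N ⟩
        factorialMoment k * (powℚ n k * powℚ 1/N k) * (n * 1/N) * (n * 1/N)
          ≡⟨ cong₂ (λ p q → factorialMoment k * p * q * q) (n^k*1/N^k≡1 k) n*1/N≡1 ⟩
        factorialMoment k * 1ℚ * 1ℚ * 1ℚ
          ≡⟨ solve 1 (λ x → x :* con 1ℚ :* con 1ℚ :* con 1ℚ := x) refl (factorialMoment k) ⟩
        factorialMoment k ∎
        where
        open ≡-Reasoning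
        G = loopTuples a b k

      scale-power : ∀ k → fromℕ (matchingCount N ℕ.* t ℕ.^ k ℕ.* (N ℕ.* N)) * scale k ≡ powℚ λ̂ k
      scale-power k = begin
        fromℕ (F ℕ.* t ℕ.^ k ℕ.* (N ℕ.* N)) * scale k
          ≡⟨ cong (_* scale k) (trans (fromℕ-* (F ℕ.* t ℕ.^ k) (N ℕ.* N))
                                 (cong₂ _*_ (trans (fromℕ-* F (t ℕ.^ k)) (cong (fromℕ F *_) (fromℕ-^ t k))) (fromℕ-* N N))) ⟩
        fromℕ F * powℚ (fromℕ t) k * (n * n) * (1/D * powℚ 1/N k * (1/N * 1/N))
          ≡⟨ solve 6 (λ f p n u q w → f :* p :* (n :* n) :* (u :* q :* (w :* w)) := (f :* u) :* (p :* q) :* (n :* w) :* (n :* w))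
                     refl (fromℕ F) (powℚ (fromℕ t) k) n 1/D (powℚ 1/N k) 1/N ⟩
        (fromℕ F * 1/D) * (powℚ (fromℕ t) k * powℚ 1/N k) * (n * 1/N) * (n * 1/N)
          ≡⟨ cong₂ (λ p q → p * (powℚ (fromℕ t) k * powℚ 1/N k) * q * q) D*1/D≡1 n*1/N≡1 ⟩
        1ℚ * (powℚ (fromℕ t) k * powℚ 1/N k) * 1ℚ * 1ℚ
          ≡⟨ solve 1 (λ x → con 1ℚ :* x :* con 1ℚ :* con 1ℚ := x) refl (powℚ (fromℕ t) k * powℚ 1/N k) ⟩
        powℚ (fromℕ t) k * powℚ 1/N k
          ≡⟨ powℚ-distrib-* (fromℕ t) 1/N k ⟨
        powℚ λ̂ k ∎
        where
        open ≡-Reasoning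
        F = matchingCount N

      scale-error : ∀ k → fromℕ (errorConst K k ℕ.* (t ℕ.* suc a ℕ.* matchingCount N ℕ.* N ℕ.^ k)) * scale k ≡ error k
      scale-error k = begin
        fromℕ (c ℕ.* (t ℕ.* suc a ℕ.* F ℕ.* N ℕ.^ k)) * scale k
          ≡⟨ cong (_* scale k) (trans (fromℕ-* c _) (cong (fromℕ c *_) (trans (fromℕ-* (t ℕ.* suc a ℕ.* F) (N ℕ.^ k))
               (cong₂ _*_ (trans (fromℕ-* (t ℕ.* suc a) F) (cong (_* fromℕ F) (fromℕ-* t (suc a)))) (fromℕ-^ N k))))) ⟩
        fromℕ c * (fromℕ t * fromℕ (suc a) * fromℕ F * powℚ n k) * (1/D * powℚ 1/N k * (1/N * 1/N))
          ≡⟨ solve 8 (λ c t s f p u q w → c :* (t :* s :* f :* p) :* (u :* q :* (w :* w)) := c :* (t :* w :* s :* w) :* (f :* u) :* (p :* q))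
                     refl (fromℕ c) (fromℕ t) (fromℕ (suc a)) (fromℕ F) (powℚ n k) 1/D (powℚ 1/N k) 1/N ⟩
        error k * (fromℕ F * 1/D) * (powℚ n k * powℚ 1/N k)
          ≡⟨ cong₂ (λ p q → error k * p * q) D*1/D≡1 (n^k*1/N^k≡1 k) ⟩
        error k * 1ℚ * 1ℚ
          ≡⟨ solve 1 (λ x → x :* con 1ℚ :* con 1ℚ := x) refl (error k) ⟩
        error k ∎
        where
        open ≡-Reasoning
        c = errorConst K k
        F = matchingCount N

      factorialMoment-≤ : ∀ k → factorialMoment k ≤ powℚ λ̂ k + error k
      factorialMoment-≤ k = subst₂ _≤_ (scale-moment k) (cong₂ _+_ (scale-power k) (scale-error k))
        (fromℕ-close (scale k) (0≤scale k) (loopTuples-close K a b k a²≤KN))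

      power-≤ : ∀ k → powℚ λ̂ k ≤ factorialMoment k + error k
      power-≤ k = subst₂ _≤_ (scale-power k) (cong₂ _+_ (scale-moment k) (scale-error k))
        (fromℕ-close (scale k) (0≤scale k) (swap (loopTuples-close K a b k a²≤KN)))

    moment-poisson-close : ∣ moment - poisson ∣ ≤ fromℕ (loopMomentConst K ℓ) * unitError
    moment-poisson-close = ∣p-q∣≤r
      (subst₂ (λ p q → p ≤ poisson + q) (sym moment≡) error≡
              (sumUpToℚ-weighted-≤ S factorialMoment (powℚ λ̂) error ℓ 0≤S factorialMoment-≤))
      (subst₂ (λ p q → poisson ≤ p + q) (sym moment≡) error≡
              (sumUpToℚ-weighted-≤ S (powℚ λ̂) factorialMoment error ℓ 0≤S power-≤))
      where
      S : ℕ → ℚ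
      S k = fromℕ (stirling2 ℓ k)
      0≤S : ∀ k → 0ℚ ≤ S k
      0≤S k = 0≤fromℕ (stirling2 ℓ k)
      moment≡ : moment ≡ sumUpToℚ (λ k → S k * factorialMoment k) ℓ
      moment≡ = fromℕ-sumUpTo-* (stirling2 ℓ) (loopTuples a b) 1/D ℓ
      error≡ : sumUpToℚ (λ k → S k * error k) ℓ ≡ fromℕ (loopMomentConst K ℓ) * unitError
      error≡ = sym (fromℕ-sumUpTo-* (stirling2 ℓ) (errorConst K) unitError ℓ)

    moment-poisson-bound : ∣ moment - poisson ∣ * ∣ moment - poisson ∣ * fromℕ (a ℕ.+ b)
                             ≤ (fromℕ (loopMomentConst K ℓ ℕ.* suc K) * λ̂) * (fromℕ (loopMomentConst K ℓ ℕ.* suc K) * λ̂)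
    moment-poisson-bound = begin
      δ * δ * n                                       ≤⟨ *-monoʳ-≤-0≤ n (0≤fromℕ N) δ²≤B² ⟩
      B * B * n                                       ≡⟨ solve 6 (λ c l s w n x → c :* (l :* s :* w) :* (c :* (l :* s :* w)) :* n
                                                                    := (c :* l) :* (c :* l) :* (s :* s :* w) :* (n :* w))
                                                                 refl C₀ λ̂ (fromℕ (suc a)) 1/N n n ⟩
      (C₀ * λ̂) * (C₀ * λ̂) * (s * s * 1/N) * (n * 1/N) ≡⟨ cong (λ p → (C₀ * λ̂) * (C₀ * λ̂) * (s * s * 1/N) * p) n*1/N≡1 ⟩
      (C₀ * λ̂) * (C₀ * λ̂) * (s * s * 1/N) * 1ℚ       ≡⟨ *-identityʳ _ ⟩
      (C₀ * λ̂) * (C₀ * λ̂) * (s * s * 1/N)            ≤⟨ *-monoˡ-≤-nonNeg ((C₀ * λ̂) * (C₀ * λ̂)) {{nonNegative (0≤* 0≤C₀λ̂ 0≤C₀λ̂)}}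
                                                                           s²/N≤ ⟩
      (C₀ * λ̂) * (C₀ * λ̂) * (fromℕ (suc K) * fromℕ (suc K))
                                                      ≡⟨ solve 3 (λ c l k → (c :* l) :* (c :* l) :* (k :* k) := (c :* k :* l) :* (c :* k :* l))
                                                                 refl C₀ λ̂ (fromℕ (suc K)) ⟩
      (C₀ * fromℕ (suc K) * λ̂) * (C₀ * fromℕ (suc K) * λ̂)
                                                      ≡⟨ cong (λ p → (p * λ̂) * (p * λ̂)) (fromℕ-* (loopMomentConst K ℓ) (suc K)) ⟨
      (fromℕ (loopMomentConst K ℓ ℕ.* suc K) * λ̂) * (fromℕ (loopMomentConst K ℓ ℕ.* suc K) * λ̂) ∎
      where
      open ≤-Reasoning
      δ  = ∣ moment - poisson ∣
      C₀ = fromℕ (loopMomentConst K ℓ)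
      B  = C₀ * unitError
      s  = fromℕ (suc a)
      0≤δ : 0ℚ ≤ δ
      0≤δ = 0≤∣p∣ (moment - poisson)
      δ²≤B² : δ * δ ≤ B * B
      δ²≤B² = ≤-trans (*-monoˡ-≤-nonNeg δ {{nonNegative 0≤δ}} moment-poisson-close)
                      (*-monoʳ-≤-0≤ B (≤-trans 0≤δ moment-poisson-close) moment-poisson-close)
      0≤C₀λ̂ : 0ℚ ≤ C₀ * λ̂
      0≤C₀λ̂ = 0≤* (0≤fromℕ (loopMomentConst K ℓ)) (0≤* (0≤fromℕ t) (0≤1/suc N-1))
      s²/N≤ : s * s * 1/N ≤ fromℕ (suc K) * fromℕ (suc K)
      s²/N≤ = begin
        s * s * 1/N                            ≡⟨ cong (_* 1/N) (fromℕ-* (suc a) (suc a)) ⟨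
        fromℕ (suc a ℕ.* suc a) * 1/N          ≤⟨ *-monoʳ-≤-0≤ 1/N (0≤1/suc N-1) (fromℕ-mono-≤ (suc²≤suc²* K a N 1≤N a²≤KN)) ⟩
        fromℕ (suc K ℕ.* suc K ℕ.* N) * 1/N    ≡⟨ cong (_* 1/N) (fromℕ-* (suc K ℕ.* suc K) N) ⟩
        fromℕ (suc K ℕ.* suc K) * n * 1/N      ≡⟨ *-assoc (fromℕ (suc K ℕ.* suc K)) n 1/N ⟩
        fromℕ (suc K ℕ.* suc K) * (n * 1/N)    ≡⟨ cong (fromℕ (suc K ℕ.* suc K) *_) n*1/N≡1 ⟩
        fromℕ (suc K ℕ.* suc K) * 1ℚ           ≡⟨ *-identityʳ _ ⟩
        fromℕ (suc K ℕ.* suc K)                ≡⟨ fromℕ-* (suc K) (suc K) ⟩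
        fromℕ (suc K) * fromℕ (suc K)          ∎
        where 1≤N = subst (1 ℕ.≤_) (sym N≡) (ℕ.s≤s ℕ.z≤n)

module ConfigurationModel where

  open import Defs
  open LoopTuples
  open LoopTupleBounds using (double)
  open FallingFactorial
  open ListSums
  open MatchingCounts
  open StirlingExpansion
  open HalfEdges
  open RationalEmbedding
  open RationalSums
  open MomentBound
  open import Data.Nat as ℕ using (ℕ; zero; suc; _+_; _*_; _∸_; _^_; _≤_; NonZero; pred)
  open import Data.Nat.Properties as ℕ using (≤-trans; m*n≢0; suc-pred)
  open import Data.Nat.Divisibility using (_∣_; divides)
  open import Data.Nat.ListAction using (sum)
  open import Data.List using (List; []; _∷_; length; map)
  open import Data.List.Properties using (length-map; map-cong)
  open import Data.List.Membership.Propositional using (_∈_)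
  open import Data.List.Membership.Propositional.Properties using (∈-map⁺; ∈-allFin)
  open import Data.List.Relation.Unary.Any using (here; there)
  open import Data.Fin using (Fin)
  open import Data.Integer using (+_)
  open import Data.Rational using (ℚ; _/_; _-_; ∣_∣) renaming (_*_ to _*ℚ_; _≤_ to _≤ℚ_)
  open import Function using (_∘_)
  open import Relation.Binary.PropositionalEquality

  ∈⇒≤sum : ∀ {m ms} → m ∈ ms → m ≤ sum ms
  ∈⇒≤sum (here refl)  = ℕ.m≤m+n _ _
  ∈⇒≤sum (there m∈ms) = ≤-trans (∈⇒≤sum m∈ms) (ℕ.m≤n+m _ _)

  square≤sumSqDeg : ∀ {n} (d : Fin n → ℕ) i → d i * d i ≤ sumSqDeg d
  square≤sumSqDeg d i = ∈⇒≤sum (∈-map⁺ (λ j → d j * d j) (∈-allFin i))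

  double≡*2 : ∀ q → double q ≡ q * 2
  double≡*2 zero    = refl
  double≡*2 (suc q) = cong (suc ∘ suc) (double≡*2 q)

  matchingCount-double-nonZero : ∀ q → NonZero (matchingCount (double q))
  matchingCount-double-nonZero zero    = _
  matchingCount-double-nonZero (suc q) =
    m*n≢0 (suc (double q)) (matchingCount (double q)) {{_}} {{matchingCount-double-nonZero q}}

  length≡sum-1 : {A : Set} (xs : List A) → length xs ≡ sum (map (λ _ → 1) xs)
  length≡sum-1 []       = refl
  length≡sum-1 (x ∷ xs) = cong suc (length≡sum-1 xs)

  average-length : ∀ xs {m} → length xs ≡ suc m → average xs ≡ (+ sum xs) / suc m
  average-length xs eq rewrite eq = refl

  lam≡ : ∀ {n} (d : Fin n → ℕ) i {m} → totalDeg d ≡ suc m → lam d i ≡ fromℕ (choose2 (d i)) *ℚ 1/suc m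
  lam≡ d i {m} eq rewrite eq = begin
    (+ (d i * (d i ∸ 1))) / (2 * suc m)          ≡⟨ cong (λ x → (+ x) / (2 * suc m)) (2*choose2 (d i)) ⟨
    (+ (2 * choose2 (d i))) / (2 * suc m)        ≡⟨ 2*/2*suc≡fromℕ*1/suc (choose2 (d i)) m ⟩
    fromℕ (choose2 (d i)) *ℚ 1/suc m             ∎
    where open ≡-Reasoning

  module _ {n : ℕ} (i : Fin n) where

    length-matchings : ∀ L → length (matchings L) ≡ matchingCount (#at i L + #off i L)
    length-matchings L = trans (length≡sum-1 (matchings L)) (loopFallingSum-matchings i L 0)

    sum-loops^ : ∀ L ℓ →
      sum (map (λ m → loopsAt i m ^ ℓ) (matchings L)) ≡ sumUpTo (λ k → stirling2 ℓ k * loopTuples (#at i L) (#off i L) k) ℓ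
    sum-loops^ L ℓ = begin
      sum (map (λ m → loopsAt i m ^ ℓ) ms)
        ≡⟨ cong sum (map-cong (λ m → ^≡stirling2-falling (loopsAt i m) ℓ) ms) ⟩
      sum (map (λ m → sumUpTo (λ k → stirling2 ℓ k * falling (loopsAt i m) k) ℓ) ms)
        ≡⟨ sum-sumUpTo (λ m k → stirling2 ℓ k * falling (loopsAt i m) k) ms ℓ ⟩
      sumUpTo (λ k → sum (map (λ m → stirling2 ℓ k * falling (loopsAt i m) k) ms)) ℓ
        ≡⟨ sumUpTo-cong ℓ (λ k → trans (sum-map-*ˡ (stirling2 ℓ k) _ ms) (cong (stirling2 ℓ k *_) (loopFallingSum-matchings i L k))) ⟩
      sumUpTo (λ k → stirling2 ℓ k * loopTuples (#at i L) (#off i L) k) ℓ ∎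
      where
      open ≡-Reasoning
      ms = matchings L

    momentLoops≡ : ∀ (d : Fin n → ℕ) ℓ {m} → matchingCount (#at i (halfEdges d) + #off i (halfEdges d)) ≡ suc m →
      momentLoops d i ℓ ≡ fromℕ (sumUpTo (λ k → stirling2 ℓ k * loopTuples (#at i (halfEdges d)) (#off i (halfEdges d)) k) ℓ) *ℚ 1/suc m
    momentLoops≡ d ℓ {m} D≡ = begin
      momentLoops d i ℓ                     ≡⟨ average-length xs (trans (length-map _ (matchings L)) (trans (length-matchings L) D≡)) ⟩
      (+ sum xs) / suc m                    ≡⟨ /suc≡fromℕ*1/suc (sum xs) m ⟩
      fromℕ (sum xs) *ℚ 1/suc m             ≡⟨ cong (λ x → fromℕ x *ℚ 1/suc m) (sum-loops^ L ℓ) ⟩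
      fromℕ (sumUpTo (λ k → stirling2 ℓ k * loopTuples (#at i L) (#off i L) k) ℓ) *ℚ 1/suc m ∎
      where
      open ≡-Reasoning
      L  = halfEdges d
      xs = map (λ m → loopsAt i m ^ ℓ) (matchings L)

  loopMoment-bound : ∀ K ℓ {n} (d : Fin n → ℕ) → 2 ∣ totalDeg d → 2 ≤ totalDeg d → sumSqDeg d ≤ K * totalDeg d → (i : Fin n) →
    ∣ momentLoops d i ℓ - poissonMoment (lam d i) ℓ ∣ *ℚ ∣ momentLoops d i ℓ - poissonMoment (lam d i) ℓ ∣ *ℚ fromℕ (totalDeg d)
      ≤ℚ (fromℕ (loopMomentConst K ℓ * suc K) *ℚ lam d i) *ℚ (fromℕ (loopMomentConst K ℓ * suc K) *ℚ lam d i)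
  loopMoment-bound K ℓ d (divides q N≡q*2) 2≤N Σd²≤KN i =
    transport (fromℕ (loopMomentConst K ℓ * suc K)) (sym moment≡) poisson≡ (cong fromℕ a+b≡N) λ̂≡ V.moment-poisson-bound
    where
    L = halfEdges d
    a = #at i L
    b = #off i L
    N = totalDeg d
    a≡di : a ≡ d i
    a≡di = #at-halfEdges i d
    a+b≡N : a + b ≡ N
    a+b≡N = trans (#at+#off≡length i L) (length-halfEdges d)
    instance
      N≢0 : NonZero N
      N≢0 = ℕ.>-nonZero (≤-trans (ℕ.s≤s ℕ.z≤n) 2≤N)
      D≢0 : NonZero (matchingCount (a + b))
      D≢0 = subst (NonZero ∘ matchingCount) (sym (trans a+b≡N (trans N≡q*2 (sym (double≡*2 q))))) (matchingCount-double-nonZero q)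
    N≡ : a + b ≡ suc (pred N)
    N≡ = trans a+b≡N (sym (suc-pred N))
    D≡ : matchingCount (a + b) ≡ suc (pred (matchingCount (a + b)))
    D≡ = sym (suc-pred (matchingCount (a + b)))
    a²≤KN : a * a ≤ K * (a + b)
    a²≤KN = subst₂ (λ x y → x * x ≤ K * y) (sym a≡di) (sym a+b≡N) (≤-trans (square≤sumSqDeg d i) Σd²≤KN)
    module V = Vertex K ℓ a b N≡ D≡ a²≤KN
    moment≡ : momentLoops d i ℓ ≡ V.moment
    moment≡ = momentLoops≡ i d ℓ D≡
    λ̂≡ : V.λ̂ ≡ lam d i
    λ̂≡ = trans (cong (λ x → fromℕ (choose2 x) *ℚ 1/suc (pred N)) a≡di) (sym (lam≡ d i (sym (suc-pred N))))
    poisson≡ : V.poisson ≡ poissonMoment (lam d i) ℓ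
    poisson≡ = trans (sym (poissonMoment≡sumUpToℚ V.λ̂ ℓ)) (cong (λ x → poissonMoment x ℓ) λ̂≡)
    transport : ∀ c {M M′ P P′ x x′ l l′ : ℚ} → M ≡ M′ → P ≡ P′ → x ≡ x′ → l ≡ l′ →
      ∣ M - P ∣ *ℚ ∣ M - P ∣ *ℚ x ≤ℚ (c *ℚ l) *ℚ (c *ℚ l) →
      ∣ M′ - P′ ∣ *ℚ ∣ M′ - P′ ∣ *ℚ x′ ≤ℚ (c *ℚ l′) *ℚ (c *ℚ l′)
    transport c refl refl refl refl bound = bound

open import Defs
open import Data.Nat as ℕ using (ℕ)
open import Data.Nat.Divisibility using (_∣_)
open import Data.Fin using (Fin)
open import Data.Product using (Σ; _×_)
open import Data.Integer using (+_)
open import Data.Rational using (ℚ; _≤_; _*_; _-_; ∣_∣; _/_; 0ℚ)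
open import Data.Product using (_,_; proj₁; proj₂)
open import Data.Rational.Properties using (≤-trans; ≤-reflexive)
open import Relation.Binary.PropositionalEquality using (sym)
open RationalEmbedding using (fromℕ; fromℕ-*; fromℕ-cancel-≤; 0≤fromℕ; natAbove)
open RationalBasics using (*-monoʳ-≤-0≤)
open MomentBound using (loopMomentConst)
open ConfigurationModel using (loopMoment-bound)

lemma3p1 : (C : ℚ) → (ℓ : ℕ) → 1 ℕ.≤ ℓ →
    Σ ℚ (λ C' → (0ℚ ≤ C') ×
      ((n : ℕ) → 1 ℕ.≤ n → (d : Fin n → ℕ) →
        2 ∣ totalDeg d → 2 ℕ.≤ totalDeg d →
        ((+ sumSqDeg d) / 1) ≤ C * ((+ totalDeg d) / 1) →
        (i : Fin n) →
        ∣ momentLoops d i ℓ - poissonMoment (lam d i) ℓ ∣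
          * ∣ momentLoops d i ℓ - poissonMoment (lam d i) ℓ ∣
          * ((+ totalDeg d) / 1)
          ≤ (C' * lam d i) * (C' * lam d i)))
lemma3p1 C ℓ _ =
  fromℕ (loopMomentConst K ℓ ℕ.* ℕ.suc K) , 0≤fromℕ (loopMomentConst K ℓ ℕ.* ℕ.suc K) ,
  λ n _ d 2∣N 2≤N Σd²≤CN i → loopMoment-bound K ℓ d 2∣N 2≤N (≤K* Σd²≤CN) i
  where
  K = proj₁ (natAbove C)
  ≤K* : ∀ {s N} → fromℕ s ≤ C * fromℕ N → s ℕ.≤ K ℕ.* N
  ≤K* {s} {N} s≤CN = fromℕ-cancel-≤ (≤-trans s≤CN
    (≤-trans (*-monoʳ-≤-0≤ (fromℕ N) (0≤fromℕ N) (proj₂ (natAbove C))) (≤-reflexive (sym (fromℕ-* K N)))))
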